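{- Let $f=f(x_1,\ldots,x_n)$ be a positive Boolean function with $k\ge 0$ relevant variables. Then $f$ has at least $k+1$ extremal points. Moreover, $f$ has exactly $k+1$ extremal points if and only if $f$ is linear read-once.
   Context: $B=\{0,1\}$. For $\mathbf{x},\mathbf{y}\in B^n$, $\mathbf{x}\preceq\mathbf{y}$ means $(\mathbf{x})_i=1\Rightarrow(\mathbf{y})_i=1$ for all $i$. A Boolean function $f$ on $B^n$ is positive if $f(\mathbf{x})=1$ and $\mathbf{x}\preceq\mathbf{y}$ imply $f(\mathbf{y})=1$. An extremal point of a positive $f$ is a point that is either a maximal false point (maximal zero) or a minimal true point (minimal one) of $f$ with respect to $\preceq$. A variable $x_k$ is relevant for $f$ if the functions obtained by fixing $x_k=0$ and $x_k=1$ are not identical. A Boolean function is linear read-once (lro) if it is constant or can be represented by a nested formula, defined recursively: the literals $x$ and $\overline{x}$ are nested formulas; and if $t$ is a nested formula not containing $x$ or $\overline{x}$, then $x\vee t$, $x\wedge t$, $\overline{x}\vee t$, $\overline{x}\wedge t$ are nested formulas. -}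

module Defs where

open import Data.Bool using (Bool; true; false; _∧_; _∨_; not)
open import Data.Bool.Properties using () renaming (_≟_ to _≟ᵇ_)
open import Data.Nat using (ℕ; zero; suc)
open import Data.Fin using (Fin)
open import Data.Fin.Properties using (all?) renaming (_≟_ to _≟ᶠ_)
open import Data.Vec using (Vec; []; _∷_; lookup; _[_]≔_)
open import Data.Vec.Properties using (≡-dec)
open import Data.List using (List; []; _∷_; length; filter; map; _++_; allFin)
open import Data.Product using (Σ; _×_; _,_; ∃)
open import Data.Sum using (_⊎_; inj₁; inj₂)
open import Data.Empty using (⊥)
open import Relation.Nullary using (¬_; Dec; yes; no)
open import Relation.Nullary.Decidable using (_×-dec_; _⊎-dec_; _→-dec_; ¬?; map′)
open import Relation.Binary.PropositionalEquality using (_≡_; refl)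

-- Points of B^n, with true = 1 and false = 0.
Point : ℕ → Set
Point n = Vec Bool n

BoolFun : ℕ → Set
BoolFun n = Point n → Bool

_⪯_ : ∀ {n} → Point n → Point n → Set
x ⪯ y = ∀ i → lookup x i ≡ true → lookup y i ≡ true

Positive : ∀ {n} → BoolFun n → Set
Positive {n} f = ∀ (x y : Point n) → f x ≡ true → x ⪯ y → f y ≡ true

MaxFalse : ∀ {n} → BoolFun n → Point n → Set
MaxFalse {n} f x = f x ≡ false × (∀ (y : Point n) → x ⪯ y → f y ≡ false → y ≡ x)

MinTrue : ∀ {n} → BoolFun n → Point n → Set
MinTrue {n} f x = f x ≡ true × (∀ (y : Point n) → y ⪯ x → f y ≡ true → y ≡ x)

Extremal : ∀ {n} → BoolFun n → Point n → Set
Extremal f x = MaxFalse f x ⊎ MinTrue f x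

Relevant : ∀ {n} → BoolFun n → Fin n → Set
Relevant {n} f i = ¬ (∀ (x : Point n) → f (x [ i ]≔ false) ≡ f (x [ i ]≔ true))

allPoints : (n : ℕ) → List (Point n)
allPoints zero = [] ∷ []
allPoints (suc n) = map (false ∷_) (allPoints n) ++ map (true ∷_) (allPoints n)

allPoint? : ∀ n {P : Point n → Set} → (∀ x → Dec (P x)) → Dec (∀ x → P x)
allPoint? zero P? = map′ (λ { p [] → p }) (λ h → h []) (P? [])
allPoint? (suc n) {P} P? =
  map′ (λ { (p , q) (false ∷ xs) → p xs ; (p , q) (true ∷ xs) → q xs })
       (λ h → (λ xs → h (false ∷ xs)) , (λ xs → h (true ∷ xs)))
       (allPoint? n (λ xs → P? (false ∷ xs)) ×-dec allPoint? n (λ xs → P? (true ∷ xs)))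

_⪯?_ : ∀ {n} (x y : Point n) → Dec (x ⪯ y)
x ⪯? y = all? (λ i → (lookup x i ≟ᵇ true) →-dec (lookup y i ≟ᵇ true))

maxFalse? : ∀ {n} (f : BoolFun n) (x : Point n) → Dec (MaxFalse f x)
maxFalse? {n} f x = (f x ≟ᵇ false) ×-dec
  allPoint? n (λ y → (x ⪯? y) →-dec ((f y ≟ᵇ false) →-dec ≡-dec _≟ᵇ_ y x))

minTrue? : ∀ {n} (f : BoolFun n) (x : Point n) → Dec (MinTrue f x)
minTrue? {n} f x = (f x ≟ᵇ true) ×-dec
  allPoint? n (λ y → (y ⪯? x) →-dec ((f y ≟ᵇ true) →-dec ≡-dec _≟ᵇ_ y x))

extremal? : ∀ {n} (f : BoolFun n) (x : Point n) → Dec (Extremal f x)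
extremal? f x = maxFalse? f x ⊎-dec minTrue? f x

relevant? : ∀ {n} (f : BoolFun n) (i : Fin n) → Dec (Relevant f i)
relevant? {n} f i = ¬? (allPoint? n (λ x → f (x [ i ]≔ false) ≟ᵇ f (x [ i ]≔ true)))

-- Number of extremal points of f (count over the duplicate-free list of all of B^n).
numExtremal : ∀ {n} → BoolFun n → ℕ
numExtremal {n} f = length (filter (extremal? f) (allPoints n))

numRelevant : ∀ {n} → BoolFun n → ℕ
numRelevant {n} f = length (filter (relevant? f) (allFin n))

data Lit (n : ℕ) : Set where
  pos : Fin n → Lit n
  neg : Fin n → Lit n

litVar : ∀ {n} → Lit n → Fin n
litVar (pos i) = i
litVar (neg i) = i

evalLit : ∀ {n} → Lit n → Point n → Bool
evalLit (pos i) x = lookup x i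
evalLit (neg i) x = not (lookup x i)

data Nested (n : ℕ) : Set where
  lit  : Lit n → Nested n
  _∨ₙ_ : Lit n → Nested n → Nested n
  _∧ₙ_ : Lit n → Nested n → Nested n

data Occurs {n : ℕ} (i : Fin n) : Nested n → Set where
  here-lit : ∀ {l} → litVar l ≡ i → Occurs i (lit l)
  here-∨   : ∀ {l t} → litVar l ≡ i → Occurs i (l ∨ₙ t)
  here-∧   : ∀ {l t} → litVar l ≡ i → Occurs i (l ∧ₙ t)
  there-∨  : ∀ {l t} → Occurs i t → Occurs i (l ∨ₙ t)
  there-∧  : ∀ {l t} → Occurs i t → Occurs i (l ∧ₙ t)

WellFormed : ∀ {n} → Nested n → Set
WellFormed (lit l)  = Data.Unit.⊤ where import Data.Unit
WellFormed (l ∨ₙ t) = ¬ Occurs (litVar l) t × WellFormed t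
WellFormed (l ∧ₙ t) = ¬ Occurs (litVar l) t × WellFormed t

eval : ∀ {n} → Nested n → Point n → Bool
eval (lit l)  x = evalLit l x
eval (l ∨ₙ t) x = evalLit l x ∨ eval t x
eval (l ∧ₙ t) x = evalLit l x ∧ eval t x

LinearReadOnce : ∀ {n} → BoolFun n → Set
LinearReadOnce {n} f =
  (Σ Bool λ b → ∀ (x : Point n) → f x ≡ b)
  ⊎ (Σ (Nested n) λ t → WellFormed t × (∀ (x : Point n) → f x ≡ eval t x))

-- Restricting a positive f along x_i gives g = f|x_i=0 ≤ h = f|x_i=1, and the
-- extremal points of f are the minimal ones of g, the maximal zeros of h, the maximal zeros of g
-- where h = 1 and the minimal ones of h where g = 0.  If x_i is relevant, points of both of the
-- last two kinds exist, so f has more extremal points than g and than h.  For x_i of least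
-- influence (fewest x with f x = 1 and f (x with x_i := 0) = 0) among the relevant variables,
-- g or h keeps every other relevant variable of f, and the lower bound follows.  When the bound
-- is attained the same count forces f to be constant or to have a canalizing variable x_k
-- (x_k = c forces f = c) whose other restriction is again tight; and the functions given by
-- nested formulas are exactly those obtained by iterated canalization.

module Submission where

open import Data.Bool using (Bool; true; false; _∧_; _∨_; not)
open import Data.Bool.Properties using (¬-not; not-involutive) renaming (_≟_ to _≟ᵇ_)
open import Data.Empty using (⊥-elim)
open import Data.Fin using (Fin; punchIn; punchOut) renaming (zero to fzero; suc to fsuc)
open import Data.Fin.Properties using (any?; punchInᵢ≢i; punchIn-punchOut; punchIn-injective) renaming (_≟_ to _≟ᶠ_)
open import Data.List using (List; []; _∷_; length; filter; map; _++_; allFin)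
open import Data.List.Properties using (map-tabulate)
open import Data.Nat using (ℕ; zero; suc; _+_; _≤_; z≤n; s≤s; s≤s⁻¹; _<?_)
open import Data.Nat.Properties
  using (≤-refl; ≤-reflexive; ≤-trans; ≤-antisym; +-comm; +-assoc; +-suc; +-mono-≤; +-monoʳ-≤;
         +-cancelˡ-≤; +-cancelʳ-≤; m≤m+n; m≤n+m; ≮⇒≥; +-identityʳ; +-commutativeSemigroup; module ≤-Reasoning)
open import Algebra.Properties.CommutativeSemigroup +-commutativeSemigroup
  using () renaming (interchange to +-interchange; x∙yz≈y∙xz to +-left-comm)
open import Data.Product using (Σ; ∃; _×_; _,_; proj₁; proj₂)
open import Data.Sum using (_⊎_; inj₁; inj₂)
open import Data.Unit using (tt)
open import Data.Vec using (Vec; []; _∷_; head; tail; lookup; _[_]≔_; insertAt; removeAt; replicate)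
open import Data.Vec.Properties
  using (insertAt-lookup; insertAt-punchIn; removeAt-insertAt; insertAt-removeAt; lookup∘update;
         lookup∘update′; lookup-replicate; tabulate∘lookup; tabulate-cong; []≔-idempotent;
         []≔-commutes; []≔-lookup)
open import Function using (_∘_; id)
open import Function.Bundles using (_⇔_; mk⇔; Equivalence)
open import Relation.Nullary using (¬_; Dec; yes; no; does)
open import Relation.Nullary.Decidable using (dec-true)
open import Relation.Binary.PropositionalEquality
  using (_≡_; _≢_; refl; sym; trans; cong; cong₂; subst; subst₂; module ≡-Reasoning)

open import Defs

private
  variable
    S : Set
    n : ℕ

true≢false : true ≢ false
true≢false ()

≡-by-truth : {a b : Bool} → (a ≡ true → b ≡ true) → (b ≡ true → a ≡ true) → a ≡ b
≡-by-truth {false} {false} _   _   = refl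
≡-by-truth {false} {true}  _   b⇒a = b⇒a refl
≡-by-truth {true}  {false} a⇒b _   = sym (a⇒b refl)
≡-by-truth {true}  {true}  _   _   = refl

≢true⇒≡false : {a : Bool} → a ≢ true → a ≡ false
≢true⇒≡false {false} _  = refl
≢true⇒≡false {true}  ¬a = ⊥-elim (¬a refl)

≢false⇒≡true : {a : Bool} → a ≢ false → a ≡ true
≢false⇒≡true {true}  _  = refl
≢false⇒≡true {false} ¬a = ⊥-elim (¬a refl)

not≡true⇒≡false : {a : Bool} → not a ≡ true → a ≡ false
not≡true⇒≡false {false} _ = refl

∨-introˡ : {a b : Bool} → a ≡ true → a ∨ b ≡ true
∨-introˡ refl = refl

∨-introʳ : {a b : Bool} → b ≡ true → a ∨ b ≡ true
∨-introʳ {false} b = b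
∨-introʳ {true}  _ = refl

∨-elim : {a b : Bool} → a ∨ b ≡ true → a ≡ true ⊎ b ≡ true
∨-elim {true}  _ = inj₁ refl
∨-elim {false} b = inj₂ b

∧-intro : {a b : Bool} → a ≡ true → b ≡ true → a ∧ b ≡ true
∧-intro refl b = b

∧-elimˡ : {a b : Bool} → a ∧ b ≡ true → a ≡ true
∧-elimˡ {true} _ = refl

∧-elimʳ : {a b : Bool} → a ∧ b ≡ true → b ≡ true
∧-elimʳ {true} b = b

does≡true⇒ : ∀ {a} {A : Set a} (a? : Dec A) → does a? ≡ true → A
does≡true⇒ (yes a) _ = a

-- Points of the cube

lookup-ext : {xs ys : Vec S n} → (∀ i → lookup xs i ≡ lookup ys i) → xs ≡ ys
lookup-ext {xs = x} {y} eq = trans (sym (tabulate∘lookup x)) (trans (tabulate-cong eq) (tabulate∘lookup y))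

ones zeros : (n : ℕ) → Point n
ones n = replicate n true
zeros n = replicate n false

insertAt-[]≔ : (y : Vec S n) (i : Fin (suc n)) (c : S) (j : Fin n) (v : S) →
               insertAt (y [ j ]≔ v) i c ≡ insertAt y i c [ punchIn i j ]≔ v
insertAt-[]≔ y       fzero    c j      v = refl
insertAt-[]≔ (a ∷ y) (fsuc i) c fzero    v = refl
insertAt-[]≔ (a ∷ y) (fsuc i) c (fsuc j) v = cong (a ∷_) (insertAt-[]≔ y i c j v)

[]≔-insertAt-removeAt : (x : Vec S (suc n)) (i : Fin (suc n)) (b : S) →
                         x [ i ]≔ b ≡ insertAt (removeAt x i) i b
[]≔-insertAt-removeAt (a ∷ x)     fzero    b = refl
[]≔-insertAt-removeAt (a ∷ c ∷ x) (fsuc i) b = cong (a ∷_) ([]≔-insertAt-removeAt (c ∷ x) i b)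

insertAt-injective : (i : Fin (suc n)) {b c : S} {y z : Vec S n} →
                     insertAt y i b ≡ insertAt z i c → b ≡ c × y ≡ z
insertAt-injective i {b} {c} {y} {z} eq =
  trans (sym (insertAt-lookup y i b)) (trans (cong (λ v → lookup v i) eq) (insertAt-lookup z i c)) ,
  trans (sym (removeAt-insertAt y i b)) (trans (cong (λ v → removeAt v i) eq) (removeAt-insertAt z i c))

insertAt-elim : (i : Fin (suc n)) (P : Vec S (suc n) → Set) →
                (∀ c y → P (insertAt y i c)) → ∀ x → P x
insertAt-elim i P p x = subst P (insertAt-removeAt x i) (p (lookup x i) (removeAt x i))

≡-or-punchIn : (i k : Fin (suc n)) → k ≡ i ⊎ ∃ λ j → k ≡ punchIn i j
≡-or-punchIn i k with i ≟ᶠ k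
... | yes i≡k = inj₁ (sym i≡k)
... | no  i≢k = inj₂ (punchOut i≢k , sym (punchIn-punchOut i≢k))

lookup-removeAt : (x : Vec S (suc n)) (i : Fin (suc n)) (j : Fin n) →
                  lookup (removeAt x i) j ≡ lookup x (punchIn i j)
lookup-removeAt x i j =
  trans (sym (insertAt-punchIn (removeAt x i) i (lookup x i) j))
        (cong (λ v → lookup v (punchIn i j)) (insertAt-removeAt x i))

lookup∘update-≢ : {i j : Fin n} (x : Vec S n) (v : S) → i ≢ j → lookup (x [ i ]≔ v) j ≡ lookup x j
lookup∘update-≢ x v i≢j = lookup∘update′ (i≢j ∘ sym) x v

[]≔-lookup-≡ : (x : Vec S n) (k : Fin n) {b : S} → lookup x k ≡ b → x [ k ]≔ b ≡ x
[]≔-lookup-≡ x k xₖ = trans (cong (x [ k ]≔_) (sym xₖ)) ([]≔-lookup x k)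

lookup-[]≔²-≢ : (x : Vec S n) {j k l : Fin n} (v : S) → l ≢ j → l ≢ k → lookup ((x [ k ]≔ v) [ j ]≔ v) l ≡ lookup x l
lookup-[]≔²-≢ x {k = k} v l≢j l≢k = trans (lookup∘update-≢ (x [ k ]≔ v) v (l≢j ∘ sym)) (lookup∘update-≢ x v (l≢k ∘ sym))

lookup-[]≔²-inner : (x : Vec S n) {j k : Fin n} (v : S) → k ≢ j → lookup ((x [ k ]≔ v) [ j ]≔ v) k ≡ v
lookup-[]≔²-inner x {k = k} v k≢j = trans (lookup∘update-≢ (x [ k ]≔ v) v (k≢j ∘ sym)) (lookup∘update k x v)

[]≔²-overwrite : (x : Vec S n) {j k : Fin n} (v w : S) → k ≢ j → ((x [ k ]≔ v) [ j ]≔ v) [ k ]≔ w ≡ (x [ j ]≔ v) [ k ]≔ w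
[]≔²-overwrite x {j} {k} v w k≢j = trans (cong (_[ k ]≔ w) ([]≔-commutes x k j k≢j)) ([]≔-idempotent (x [ j ]≔ v) k)

insertAt-replicate : (i : Fin (suc n)) (b : S) → insertAt (replicate n b) i b ≡ replicate (suc n) b
insertAt-replicate {n}     fzero    b = refl
insertAt-replicate {suc n} (fsuc i) b = cong (b ∷_) (insertAt-replicate i b)

⪯-refl : {x : Point n} → x ⪯ x
⪯-refl _ xᵢ = xᵢ

⪯-trans : {x y z : Point n} → x ⪯ y → y ⪯ z → x ⪯ z
⪯-trans x⪯y y⪯z i xᵢ = y⪯z i (x⪯y i xᵢ)

⪯-antisym : {x y : Point n} → x ⪯ y → y ⪯ x → x ≡ y
⪯-antisym x⪯y y⪯x = lookup-ext λ i → ≡-by-truth (x⪯y i) (y⪯x i)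

⪯-ones : (x : Point n) → x ⪯ ones n
⪯-ones _ i _ = lookup-replicate i true

zeros-⪯ : (x : Point n) → zeros n ⪯ x
zeros-⪯ _ i 0ᵢ = ⊥-elim (true≢false (trans (sym 0ᵢ) (lookup-replicate i false)))

∷-mono : {b c : Bool} {y z : Point n} → (b ≡ true → c ≡ true) → y ⪯ z → (b ∷ y) ⪯ (c ∷ z)
∷-mono b⇒c _   fzero    = b⇒c
∷-mono _   y⪯z (fsuc i) = y⪯z i

∷-mono⁻¹ : {b c : Bool} {y z : Point n} → (b ∷ y) ⪯ (c ∷ z) → y ⪯ z
∷-mono⁻¹ by⪯cz i = by⪯cz (fsuc i)

insertAt-mono : (i : Fin (suc n)) {b c : Bool} {y z : Point n} →
                (b ≡ true → c ≡ true) → y ⪯ z → insertAt y i b ⪯ insertAt z i c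
insertAt-mono i {b} {c} {y} {z} b⇒c y⪯z k yₖ with ≡-or-punchIn i k
... | inj₁ refl = trans (insertAt-lookup z i c) (b⇒c (trans (sym (insertAt-lookup y i b)) yₖ))
... | inj₂ (j , refl) = trans (insertAt-punchIn z i c j) (y⪯z j (trans (sym (insertAt-punchIn y i b j)) yₖ))

insertAt-mono⁻¹ˡ : (i : Fin (suc n)) {b c : Bool} {y z : Point n} →
                   insertAt y i b ⪯ insertAt z i c → b ≡ true → c ≡ true
insertAt-mono⁻¹ˡ i {b} {c} {y} {z} by⪯cz b≡true =
  trans (sym (insertAt-lookup z i c)) (by⪯cz i (trans (insertAt-lookup y i b) b≡true))

insertAt-mono⁻¹ʳ : (i : Fin (suc n)) {b c : Bool} {y z : Point n} →
                   insertAt y i b ⪯ insertAt z i c → y ⪯ z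
insertAt-mono⁻¹ʳ i {b} {c} {y} {z} by⪯cz j yⱼ =
  trans (sym (insertAt-punchIn z i c j)) (by⪯cz (punchIn i j) (trans (insertAt-punchIn y i b j) yⱼ))

[]≔false-⪯ : (x : Point n) (k : Fin n) → (x [ k ]≔ false) ⪯ x
[]≔false-⪯ x k j xⱼ with k ≟ᶠ j
... | yes refl = ⊥-elim (true≢false (trans (sym xⱼ) (lookup∘update k x false)))
... | no  k≢j  = trans (sym (lookup∘update-≢ x false k≢j)) xⱼ

⪯-[]≔true : (x : Point n) (k : Fin n) → x ⪯ (x [ k ]≔ true)
⪯-[]≔true x k j xⱼ with k ≟ᶠ j
... | yes refl = lookup∘update k x true
... | no  k≢j  = trans (lookup∘update-≢ x true k≢j) xⱼ

[]≔-mono : {x y : Point n} (k : Fin n) (v : Bool) → x ⪯ y → (x [ k ]≔ v) ⪯ (y [ k ]≔ v)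
[]≔-mono {x = x} {y} k v x⪯y j xⱼ with k ≟ᶠ j
... | yes refl = trans (lookup∘update k y v) (trans (sym (lookup∘update k x v)) xⱼ)
... | no  k≢j  = trans (lookup∘update-≢ y v k≢j) (x⪯y j (trans (sym (lookup∘update-≢ x v k≢j)) xⱼ))

[]≔true-⪯ : {x u : Point n} (k : Fin n) → x ⪯ u → lookup u k ≡ true → (x [ k ]≔ true) ⪯ u
[]≔true-⪯ {x = x} k x⪯u uₖ j xⱼ with k ≟ᶠ j
... | yes refl = uₖ
... | no  k≢j  = x⪯u j (trans (sym (lookup∘update-≢ x true k≢j)) xⱼ)

⪯-[]≔false : {x u : Point n} (k : Fin n) → u ⪯ x → lookup u k ≡ false → u ⪯ (x [ k ]≔ false)
⪯-[]≔false {x = x} k u⪯x uₖ j uⱼ with k ≟ᶠ j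
... | yes refl = ⊥-elim (true≢false (trans (sym uⱼ) uₖ))
... | no  k≢j  = trans (lookup∘update-≢ x false k≢j) (u⪯x j uⱼ)

-- Positive functions

positive-false : {f : BoolFun n} → Positive f → {x y : Point n} → x ⪯ y → f y ≡ false → f x ≡ false
positive-false pf x⪯y fy = ≢true⇒≡false λ fx → true≢false (trans (sym (pf _ _ fx x⪯y)) fy)

restrict : BoolFun (suc n) → Fin (suc n) → Bool → BoolFun n
restrict f i b y = f (insertAt y i b)

restrict-positive : {f : BoolFun (suc n)} → Positive f → ∀ i b → Positive (restrict f i b)
restrict-positive pf i b y z fy y⪯z = pf _ _ fy (insertAt-mono i id y⪯z)

maxFalse-value : {f : BoolFun n} {x : Point n} → MaxFalse f x → f x ≡ false
maxFalse-value = proj₁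

minTrue-value : {f : BoolFun n} {x : Point n} → MinTrue f x → f x ≡ true
minTrue-value = proj₁

minTrue-false∷ : {f : BoolFun (suc n)} {w : Point n} → MinTrue (f ∘ (false ∷_)) w → MinTrue f (false ∷ w)
minTrue-false∷ (fw , min) = fw , λ where
  (false ∷ z) z⪯w fz → cong (false ∷_) (min z (∷-mono⁻¹ z⪯w) fz)
  (true ∷ z)  z⪯w _  → ⊥-elim (true≢false (sym (z⪯w fzero refl)))

minTrue-true∷ : {f : BoolFun (suc n)} → Positive f → {y w : Point n} → f (false ∷ y) ≡ false → w ⪯ y →
                MinTrue (f ∘ (true ∷_)) w → MinTrue f (true ∷ w)
minTrue-true∷ pf {y} {w} f0y w⪯y (fw , min) = fw , λ where
  (true ∷ z)  z⪯w fz → cong (true ∷_) (min z (∷-mono⁻¹ z⪯w) fz)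
  (false ∷ z) z⪯w fz → ⊥-elim (true≢false (trans (sym (pf _ _ fz (∷-mono (λ ()) (⪯-trans {x = z} {w} {y} (∷-mono⁻¹ z⪯w) w⪯y)))) f0y))

maxFalse-true∷ : {f : BoolFun (suc n)} {w : Point n} → MaxFalse (f ∘ (true ∷_)) w → MaxFalse f (true ∷ w)
maxFalse-true∷ (fw , max) = fw , λ where
  (true ∷ z)  w⪯z fz → cong (true ∷_) (max z (∷-mono⁻¹ w⪯z) fz)
  (false ∷ z) w⪯z _  → ⊥-elim (true≢false (sym (w⪯z fzero refl)))

maxFalse-false∷ : {f : BoolFun (suc n)} → Positive f → {y w : Point n} → f (true ∷ y) ≡ true → y ⪯ w →
                  MaxFalse (f ∘ (false ∷_)) w → MaxFalse f (false ∷ w)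
maxFalse-false∷ pf {y} {w} f1y y⪯w (fw , max) = fw , λ where
  (false ∷ z) w⪯z fz → cong (false ∷_) (max z (∷-mono⁻¹ w⪯z) fz)
  (true ∷ z)  w⪯z fz → ⊥-elim (true≢false (trans (sym (pf _ _ f1y (∷-mono id (⪯-trans {x = y} {w} {z} y⪯w (∷-mono⁻¹ w⪯z))))) fz))

∷-positive : {f : BoolFun (suc n)} → Positive f → ∀ b → Positive (f ∘ (b ∷_))
∷-positive pf b y z fy y⪯z = pf _ _ fy (∷-mono id y⪯z)

minTrue-below : (f : BoolFun n) → Positive f → (y : Point n) → f y ≡ true → ∃ λ w → w ⪯ y × MinTrue f w
minTrue-below {zero} f _ [] fy = [] , ⪯-refl {x = []} , fy , λ { [] _ _ → refl }
minTrue-below {suc n} f pf (b ∷ y) fy with f (false ∷ y) in f0y | b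
... | true | _ =
  let (w , w⪯y , min) = minTrue-below (f ∘ (false ∷_)) (∷-positive pf false) y f0y
  in false ∷ w , ∷-mono (λ ()) w⪯y , minTrue-false∷ min
... | false | true =
  let (w , w⪯y , min) = minTrue-below (f ∘ (true ∷_)) (∷-positive pf true) y fy
  in true ∷ w , ∷-mono id w⪯y , minTrue-true∷ pf f0y w⪯y min
... | false | false = ⊥-elim (true≢false (trans (sym fy) f0y))

maxFalse-above : (f : BoolFun n) → Positive f → (y : Point n) → f y ≡ false → ∃ λ w → y ⪯ w × MaxFalse f w
maxFalse-above {zero} f _ [] fy = [] , ⪯-refl {x = []} , fy , λ { [] _ _ → refl }
maxFalse-above {suc n} f pf (b ∷ y) fy with f (true ∷ y) in f1y | b
... | false | _ =
  let (w , y⪯w , max) = maxFalse-above (f ∘ (true ∷_)) (∷-positive pf true) y f1y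
  in true ∷ w , ∷-mono (λ _ → refl) y⪯w , maxFalse-true∷ max
... | true | false =
  let (w , y⪯w , max) = maxFalse-above (f ∘ (false ∷_)) (∷-positive pf false) y fy
  in false ∷ w , ∷-mono id y⪯w , maxFalse-false∷ pf f1y y⪯w max
... | true | true = ⊥-elim (true≢false (trans (sym f1y) fy))

maxFalse-by-flips : {f : BoolFun n} → Positive f → {x : Point n} → f x ≡ false →
                    (∀ k → lookup x k ≡ false → f (x [ k ]≔ true) ≡ true) → MaxFalse f x
maxFalse-by-flips {f = f} pf {x} fx flip = fx , λ u x⪯u fu → sym (lookup-ext λ k → ≡-by-truth (x⪯u k) (u⇒x u x⪯u fu k))
  where
  u⇒x : ∀ u → x ⪯ u → f u ≡ false → ∀ k → lookup u k ≡ true → lookup x k ≡ true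
  u⇒x u x⪯u fu k uₖ = ≢false⇒≡true λ xₖ →
    true≢false (trans (sym (pf _ u (flip k xₖ) ([]≔true-⪯ {x = x} {u} k x⪯u uₖ))) fu)

minTrue-by-flips : {f : BoolFun n} → Positive f → {x : Point n} → f x ≡ true →
                   (∀ k → lookup x k ≡ true → f (x [ k ]≔ false) ≡ false) → MinTrue f x
minTrue-by-flips {f = f} pf {x} fx flip = fx , λ u u⪯x fu → lookup-ext λ k → ≡-by-truth (u⪯x k) (x⇒u u u⪯x fu k)
  where
  x⇒u : ∀ u → u ⪯ x → f u ≡ true → ∀ k → lookup x k ≡ true → lookup u k ≡ true
  x⇒u u u⪯x fu k xₖ = ≢false⇒≡true λ uₖ →
    true≢false (trans (sym (pf u _ fu (⪯-[]≔false {x = x} {u} k u⪯x uₖ))) (flip k xₖ))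

-- Counting

toℕ : Bool → ℕ
toℕ false = 0
toℕ true  = 1

count : (n : ℕ) → (Point n → Bool) → ℕ
count zero    p = toℕ (p [])
count (suc n) p = count n (p ∘ (false ∷_)) + count n (p ∘ (true ∷_))

count-cong : (n : ℕ) {p q : Point n → Bool} → (∀ x → p x ≡ q x) → count n p ≡ count n q
count-cong zero    p≗q = cong toℕ (p≗q [])
count-cong (suc n) p≗q = cong₂ _+_ (count-cong n (p≗q ∘ (false ∷_))) (count-cong n (p≗q ∘ (true ∷_)))

toℕ-mono : {a b : Bool} → (a ≡ true → b ≡ true) → toℕ a ≤ toℕ b
toℕ-mono {false} _   = z≤n
toℕ-mono {true}  a⇒b with a⇒b refl
... | refl = ≤-refl

count-mono : (n : ℕ) {p q : Point n → Bool} → (∀ x → p x ≡ true → q x ≡ true) → count n p ≤ count n q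
count-mono zero    p⊆q = toℕ-mono (p⊆q [])
count-mono (suc n) p⊆q = +-mono-≤ (count-mono n (p⊆q ∘ (false ∷_))) (count-mono n (p⊆q ∘ (true ∷_)))

count-none : (n : ℕ) {p : Point n → Bool} → (∀ x → p x ≢ true) → count n p ≡ 0
count-none zero {p} none with p [] in p[]
... | true  = ⊥-elim (none [] p[])
... | false = refl
count-none (suc n) none = cong₂ _+_ (count-none n (none ∘ (false ∷_))) (count-none n (none ∘ (true ∷_)))

count-pos : (n : ℕ) (p : Point n → Bool) (x : Point n) → p x ≡ true → 1 ≤ count n p
count-pos zero    p []          px rewrite px = ≤-refl
count-pos (suc n) p (false ∷ x) px = ≤-trans (count-pos n _ x px) (m≤m+n _ _)
count-pos (suc n) p (true ∷ x)  px = ≤-trans (count-pos n _ x px) (m≤n+m _ _)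

toℕ-∨-∧ : ∀ a b → toℕ (a ∨ b) + toℕ (a ∧ b) ≡ toℕ a + toℕ b
toℕ-∨-∧ true  true  = refl
toℕ-∨-∧ true  false = refl
toℕ-∨-∧ false true  = refl
toℕ-∨-∧ false false = refl

count-∨-∧ : (n : ℕ) (p q : Point n → Bool) →
            count n (λ x → p x ∨ q x) + count n (λ x → p x ∧ q x) ≡ count n p + count n q
count-∨-∧ zero    p q = toℕ-∨-∧ (p []) (q [])
count-∨-∧ (suc n) p q =
  trans (+-interchange (count n (λ y → p (false ∷ y) ∨ q (false ∷ y))) _ _ _)
  (trans (cong₂ _+_ (count-∨-∧ n (p ∘ (false ∷_)) (q ∘ (false ∷_))) (count-∨-∧ n (p ∘ (true ∷_)) (q ∘ (true ∷_))))
         (+-interchange (count n (p ∘ (false ∷_))) _ _ _))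

count-∨-disjoint : (n : ℕ) (p q : Point n → Bool) → (∀ x → p x ≡ true → q x ≢ true) →
                   count n (λ x → p x ∨ q x) ≡ count n p + count n q
count-∨-disjoint n p q disjoint =
  trans (sym (+-identityʳ _))
  (trans (cong (count n (λ x → p x ∨ q x) +_) (sym (count-none n λ x pq → disjoint x (∧-elimˡ pq) (∧-elimʳ pq))))
         (count-∨-∧ n p q))

count-∧-split : (n : ℕ) (p q : Point n → Bool) →
                count n p ≡ count n (λ x → p x ∧ q x) + count n (λ x → p x ∧ not (q x))
count-∧-split n p q =
  trans (count-cong n split) (count-∨-disjoint n _ _ λ x pq p¬q → true≢false
    (trans (sym (∧-elimʳ {p x} pq)) (not≡true⇒≡false (∧-elimʳ {p x} p¬q))))
  where
  split : ∀ x → p x ≡ (p x ∧ q x) ∨ (p x ∧ not (q x))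
  split x with p x | q x
  ... | true  | true  = refl
  ... | true  | false = refl
  ... | false | _     = refl

count≤1⇒unique : (n : ℕ) (p : Point n → Bool) → count n p ≤ 1 →
                 ∀ x y → p x ≡ true → p y ≡ true → x ≡ y
count≤1⇒unique zero p _ [] [] _ _ = refl
count≤1⇒unique (suc n) p ≤1 (false ∷ x) (false ∷ y) px py =
  cong (false ∷_) (count≤1⇒unique n _ (≤-trans (m≤m+n _ _) ≤1) x y px py)
count≤1⇒unique (suc n) p ≤1 (true ∷ x) (true ∷ y) px py =
  cong (true ∷_) (count≤1⇒unique n _ (≤-trans (m≤n+m _ _) ≤1) x y px py)
count≤1⇒unique (suc n) p ≤1 (false ∷ x) (true ∷ y) px py
  with ≤-trans (+-mono-≤ (count-pos n _ x px) (count-pos n _ y py)) ≤1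
... | s≤s ()
count≤1⇒unique (suc n) p ≤1 (true ∷ x) (false ∷ y) px py
  with ≤-trans (+-mono-≤ (count-pos n _ y py) (count-pos n _ x px)) ≤1
... | s≤s ()

unique⇒count≤1 : (n : ℕ) (p : Point n → Bool) (x₀ : Point n) → (∀ x → p x ≡ true → x ≡ x₀) → count n p ≤ 1
unique⇒count≤1 zero p [] _ with p []
... | true  = ≤-refl
... | false = z≤n
unique⇒count≤1 (suc n) p (false ∷ x₀) uniq =
  subst (_≤ 1) (sym (trans (cong (count n (p ∘ (false ∷_)) +_) (count-none n other)) (+-identityʳ _)))
        (unique⇒count≤1 n _ x₀ λ x px → cong tail (uniq _ px))
  where
  other : ∀ x → p (true ∷ x) ≢ true
  other x px = true≢false (cong head (uniq _ px))
unique⇒count≤1 (suc n) p (true ∷ x₀) uniq =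
  subst (_≤ 1) (sym (cong (_+ count n (p ∘ (true ∷_))) (count-none n other)))
        (unique⇒count≤1 n _ x₀ λ x px → cong tail (uniq _ px))
  where
  other : ∀ x → p (false ∷ x) ≢ true
  other x px = true≢false (sym (cong head (uniq _ px)))

count-⊆-≥⇒⊇ : (n : ℕ) (p q : Point n → Bool) → (∀ x → p x ≡ true → q x ≡ true) → count n q ≤ count n p →
              ∀ x → q x ≡ true → p x ≡ true
count-⊆-≥⇒⊇ zero p q p⊆q q≤p [] with p [] | q [] | p⊆q []
... | true  | _     | _   = λ _ → refl
... | false | false | _   = λ ()
... | false | true  | _   with q≤p
...   | ()
count-⊆-≥⇒⊇ (suc n) p q p⊆q q≤p (b ∷ x) = halves b x
  where
  lower : count n (q ∘ (false ∷_)) ≤ count n (p ∘ (false ∷_))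
  lower = +-cancelʳ-≤ _ _ _ (≤-trans q≤p (+-mono-≤ ≤-refl (count-mono n (p⊆q ∘ (true ∷_)))))
  upper : count n (q ∘ (true ∷_)) ≤ count n (p ∘ (true ∷_))
  upper = +-cancelˡ-≤ _ _ _ (≤-trans q≤p (+-mono-≤ (count-mono n (p⊆q ∘ (false ∷_))) ≤-refl))
  halves : ∀ b x → q (b ∷ x) ≡ true → p (b ∷ x) ≡ true
  halves false = count-⊆-≥⇒⊇ n _ _ (p⊆q ∘ (false ∷_)) lower
  halves true  = count-⊆-≥⇒⊇ n _ _ (p⊆q ∘ (true ∷_)) upper

count-insertAt : (n : ℕ) (p : Point (suc n) → Bool) (i : Fin (suc n)) →
                 count (suc n) p ≡ count n (λ y → p (insertAt y i false)) + count n (λ y → p (insertAt y i true))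
count-insertAt n       p fzero    = refl
count-insertAt (suc n) p (fsuc i) =
  trans (cong₂ _+_ (count-insertAt n (p ∘ (false ∷_)) i) (count-insertAt n (p ∘ (true ∷_)) i))
        (+-interchange (count n (λ y → p (false ∷ insertAt y i false))) _ _ _)

allPoints-false⊎some-true : (n : ℕ) (p : Point n → Bool) → (∀ x → p x ≡ false) ⊎ ∃ λ x → p x ≡ true
allPoints-false⊎some-true zero p with p [] in p[]
... | true  = inj₂ ([] , p[])
... | false = inj₁ λ { [] → p[] }
allPoints-false⊎some-true (suc n) p
  with allPoints-false⊎some-true n (p ∘ (false ∷_)) | allPoints-false⊎some-true n (p ∘ (true ∷_))
... | inj₂ (y , py) | _             = inj₂ (false ∷ y , py)
... | inj₁ _        | inj₂ (y , py) = inj₂ (true ∷ y , py)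
... | inj₁ none₀    | inj₁ none₁    = inj₁ λ { (false ∷ y) → none₀ y ; (true ∷ y) → none₁ y }

countFin : (n : ℕ) → (Fin n → Bool) → ℕ
countFin zero    q = 0
countFin (suc n) q = toℕ (q fzero) + countFin n (q ∘ fsuc)

countFin-cong : (n : ℕ) {p q : Fin n → Bool} → (∀ j → p j ≡ q j) → countFin n p ≡ countFin n q
countFin-cong zero    _   = refl
countFin-cong (suc n) p≗q = cong₂ _+_ (cong toℕ (p≗q fzero)) (countFin-cong n (p≗q ∘ fsuc))

countFin-punchIn : (n : ℕ) (q : Fin (suc n) → Bool) (i : Fin (suc n)) →
                   countFin (suc n) q ≡ toℕ (q i) + countFin n (q ∘ punchIn i)
countFin-punchIn n       q fzero    = refl
countFin-punchIn (suc n) q (fsuc i) =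
  trans (cong (toℕ (q fzero) +_) (countFin-punchIn n (q ∘ fsuc) i)) (+-left-comm (toℕ (q fzero)) (toℕ (q (fsuc i))) _)

countFin-none : (n : ℕ) (q : Fin n → Bool) → (∀ j → q j ≡ false) → countFin n q ≡ 0
countFin-none zero    q _    = refl
countFin-none (suc n) q none rewrite none fzero = countFin-none n _ (none ∘ fsuc)

all-false⊎some-true : (q : Fin n → Bool) → (∀ j → q j ≡ false) ⊎ ∃ λ j → q j ≡ true
all-false⊎some-true q with any? (λ j → q j ≟ᵇ true)
... | yes found = inj₂ found
... | no  none  = inj₁ λ j → ≢true⇒≡false λ qj → none (j , qj)

countList : {A : Set} → (A → Bool) → List A → ℕ
countList p []       = 0
countList p (x ∷ xs) = toℕ (p x) + countList p xs

length-filter≡countList : {A : Set} {P : A → Set} (P? : ∀ x → Dec (P x)) (xs : List A) →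
                          length (filter P? xs) ≡ countList (does ∘ P?) xs
length-filter≡countList P? []       = refl
length-filter≡countList P? (x ∷ xs) with does (P? x)
... | true  = cong suc (length-filter≡countList P? xs)
... | false = length-filter≡countList P? xs

countList-++ : {A : Set} (p : A → Bool) (xs ys : List A) → countList p (xs ++ ys) ≡ countList p xs + countList p ys
countList-++ p []       ys = refl
countList-++ p (x ∷ xs) ys = trans (cong (toℕ (p x) +_) (countList-++ p xs ys)) (sym (+-assoc (toℕ (p x)) _ _))

countList-map : {A B : Set} (p : B → Bool) (g : A → B) (xs : List A) → countList p (map g xs) ≡ countList (p ∘ g) xs
countList-map p g []       = refl
countList-map p g (x ∷ xs) = cong (toℕ (p (g x)) +_) (countList-map p g xs)

countList-allPoints : (n : ℕ) (p : Point n → Bool) → countList p (allPoints n) ≡ count n p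
countList-allPoints zero    p = +-identityʳ (toℕ (p []))
countList-allPoints (suc n) p =
  trans (countList-++ p (map (false ∷_) (allPoints n)) _)
        (cong₂ _+_ (trans (countList-map p _ (allPoints n)) (countList-allPoints n _))
                   (trans (countList-map p _ (allPoints n)) (countList-allPoints n _)))

countList-allFin : (n : ℕ) (q : Fin n → Bool) → countList q (allFin n) ≡ countFin n q
countList-allFin zero    q = refl
countList-allFin (suc n) q =
  cong (toℕ (q fzero) +_)
       (trans (cong (countList q) (sym (map-tabulate id fsuc)))
              (trans (countList-map q fsuc (allFin n)) (countList-allFin n (q ∘ fsuc))))

-- Extremal points and relevant variables

maxFalseᵇ minTrueᵇ extremalᵇ : BoolFun n → Point n → Bool
maxFalseᵇ f x = does (maxFalse? f x)
minTrueᵇ  f x = does (minTrue? f x)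
extremalᵇ f x = does (extremal? f x)

relevantᵇ : BoolFun n → Fin n → Bool
relevantᵇ f k = does (relevant? f k)

#extremal : BoolFun n → ℕ
#extremal {n} f = count n (extremalᵇ f)

#relevant : BoolFun n → ℕ
#relevant {n} f = countFin n (relevantᵇ f)

numExtremal≡#extremal : (f : BoolFun n) → numExtremal f ≡ #extremal f
numExtremal≡#extremal {n} f =
  trans (length-filter≡countList (extremal? f) (allPoints n)) (countList-allPoints n (extremalᵇ f))

numRelevant≡#relevant : (f : BoolFun n) → numRelevant f ≡ #relevant f
numRelevant≡#relevant {n} f =
  trans (length-filter≡countList (relevant? f) (allFin n)) (countList-allFin n (relevantᵇ f))

maxFalseᵇ-sound : (f : BoolFun n) (x : Point n) → maxFalseᵇ f x ≡ true → MaxFalse f x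
maxFalseᵇ-sound f x = does≡true⇒ (maxFalse? f x)

maxFalseᵇ-complete : (f : BoolFun n) (x : Point n) → MaxFalse f x → maxFalseᵇ f x ≡ true
maxFalseᵇ-complete f x = dec-true (maxFalse? f x)

minTrueᵇ-sound : (f : BoolFun n) (x : Point n) → minTrueᵇ f x ≡ true → MinTrue f x
minTrueᵇ-sound f x = does≡true⇒ (minTrue? f x)

minTrueᵇ-complete : (f : BoolFun n) (x : Point n) → MinTrue f x → minTrueᵇ f x ≡ true
minTrueᵇ-complete f x = dec-true (minTrue? f x)

maxFalse-minTrue-disjoint : (f : BoolFun n) (x : Point n) → maxFalseᵇ f x ≡ true → minTrueᵇ f x ≢ true
maxFalse-minTrue-disjoint f x mf mt =
  true≢false (trans (sym (minTrue-value (minTrueᵇ-sound f x mt))) (maxFalse-value (maxFalseᵇ-sound f x mf)))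

#extremal≡ : (f : BoolFun n) → #extremal f ≡ count n (maxFalseᵇ f) + count n (minTrueᵇ f)
#extremal≡ {n} f = count-∨-disjoint n (maxFalseᵇ f) (minTrueᵇ f) (maxFalse-minTrue-disjoint f)

1≤#extremal : (f : BoolFun n) → Positive f → 1 ≤ #extremal f
1≤#extremal {n} f pf with f (ones n) in f1
... | false = count-pos n _ (ones n)
                (∨-introˡ (maxFalseᵇ-complete f _ (f1 , λ z 1⪯z _ → ⪯-antisym (⪯-ones z) 1⪯z)))
... | true  = let (w , _ , min) = minTrue-below f pf (ones n) f1
              in count-pos n _ w (∨-introʳ {maxFalseᵇ f w} (minTrueᵇ-complete f w min))

Irrelevant : BoolFun n → Fin n → Set
Irrelevant {n} f k = ∀ (x : Point n) → f (x [ k ]≔ false) ≡ f (x [ k ]≔ true)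

irrelevant? : (f : BoolFun n) (k : Fin n) → Dec (Irrelevant f k)
irrelevant? {n} f k = allPoint? n λ x → f (x [ k ]≔ false) ≟ᵇ f (x [ k ]≔ true)

relevantᵇ≡false⇒irrelevant : (f : BoolFun n) (k : Fin n) → relevantᵇ f k ≡ false → Irrelevant f k
relevantᵇ≡false⇒irrelevant f k r = does≡true⇒ (irrelevant? f k) (not-injective r)
  where
  not-injective : {a : Bool} → not a ≡ false → a ≡ true
  not-injective {true} _ = refl

irrelevant⇒relevantᵇ≡false : (f : BoolFun n) (k : Fin n) → Irrelevant f k → relevantᵇ f k ≡ false
irrelevant⇒relevantᵇ≡false f k irr = cong not (dec-true (irrelevant? f k) irr)

irrelevant-reset : (f : BoolFun n) (x : Point n) (k : Fin n) →
                   f (x [ k ]≔ false) ≡ f (x [ k ]≔ true) → ∀ b → f x ≡ f (x [ k ]≔ b)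
irrelevant-reset f x k irr b with lookup x k in xₖ
... | false = trans (cong f (sym ([]≔-lookup-≡ x k xₖ))) (reset b)
  where
  reset : ∀ b → f (x [ k ]≔ false) ≡ f (x [ k ]≔ b)
  reset false = refl
  reset true  = irr
... | true  = trans (cong f (sym ([]≔-lookup-≡ x k xₖ))) (reset b)
  where
  reset : ∀ b → f (x [ k ]≔ true) ≡ f (x [ k ]≔ b)
  reset false = sym irr
  reset true  = refl

Constant : BoolFun n → Set
Constant {n} f = Σ Bool λ b → ∀ (x : Point n) → f x ≡ b

all-irrelevant⇒constant : (f : BoolFun n) → (∀ j → Irrelevant f j) → Constant f
all-irrelevant⇒constant {n} f irr = f (zeros n) , go n f irr
  where
  go : ∀ n (f : BoolFun n) → (∀ j → Irrelevant f j) → ∀ x → f x ≡ f (zeros n)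
  go zero    f _   [] = refl
  go (suc n) f irr (b ∷ x) =
    trans (irrelevant-reset f (b ∷ x) fzero (irr fzero (b ∷ x)) false)
          (go n (f ∘ (false ∷_)) (λ j y → irr (fsuc j) (false ∷ y)) x)

constant⇒irrelevant : (f : BoolFun n) → Constant f → ∀ j → Irrelevant f j
constant⇒irrelevant f (b , f≡b) j x = trans (f≡b _) (sym (f≡b _))

constant⇒#extremal≤1 : (f : BoolFun n) → Constant f → #extremal f ≤ 1
constant⇒#extremal≤1 {n} f (true , f≡1) = unique⇒count≤1 n (extremalᵇ f) (zeros n) only-zeros
  where
  only-zeros : ∀ x → extremalᵇ f x ≡ true → x ≡ zeros n
  only-zeros x ex with ∨-elim {maxFalseᵇ f x} ex
  ... | inj₁ mf = ⊥-elim (true≢false (trans (sym (f≡1 x)) (maxFalse-value (maxFalseᵇ-sound f x mf))))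
  ... | inj₂ mt = sym (proj₂ (minTrueᵇ-sound f x mt) (zeros n) (zeros-⪯ x) (f≡1 _))
constant⇒#extremal≤1 {n} f (false , f≡0) = unique⇒count≤1 n (extremalᵇ f) (ones n) only-ones
  where
  only-ones : ∀ x → extremalᵇ f x ≡ true → x ≡ ones n
  only-ones x ex with ∨-elim {maxFalseᵇ f x} ex
  ... | inj₁ mf = sym (proj₂ (maxFalseᵇ-sound f x mf) (ones n) (⪯-ones x) (f≡0 _))
  ... | inj₂ mt = ⊥-elim (true≢false (trans (sym (minTrue-value (minTrueᵇ-sound f x mt))) (f≡0 x)))

restrict-irrelevant : (f : BoolFun (suc n)) (i : Fin (suc n)) (b : Bool) (j : Fin n) →
                      Irrelevant f (punchIn i j) → Irrelevant (restrict f i b) j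
restrict-irrelevant f i b j irr y =
  trans (cong f (insertAt-[]≔ y i b j false)) (trans (irr _) (cong f (sym (insertAt-[]≔ y i b j true))))

irrelevant-restricts : (f : BoolFun (suc n)) (i : Fin (suc n)) (j : Fin n) →
                       (∀ b → Irrelevant (restrict f i b) j) → Irrelevant f (punchIn i j)
irrelevant-restricts f i j irr =
  insertAt-elim i (λ x → f (x [ punchIn i j ]≔ false) ≡ f (x [ punchIn i j ]≔ true)) λ b y →
    trans (cong f (sym (insertAt-[]≔ y i b j false))) (trans (irr b y) (cong f (insertAt-[]≔ y i b j true)))

restricts-equal⇒irrelevant : (f : BoolFun (suc n)) (i : Fin (suc n)) →
                             (∀ y → restrict f i false y ≡ restrict f i true y) → Irrelevant f i
restricts-equal⇒irrelevant f i eq x =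
  trans (cong f ([]≔-insertAt-removeAt x i false)) (trans (eq _) (cong f (sym ([]≔-insertAt-removeAt x i true))))

relevant-restrict⇒relevant : (f : BoolFun (suc n)) (i : Fin (suc n)) (b : Bool) (j : Fin n) →
                             relevantᵇ (restrict f i b) j ≡ true → relevantᵇ f (punchIn i j) ≡ true
relevant-restrict⇒relevant f i b j rel = ≢false⇒≡true λ irr →
  true≢false (trans (sym rel) (irrelevant⇒relevantᵇ≡false (restrict f i b) j
    (restrict-irrelevant f i b j (relevantᵇ≡false⇒irrelevant f _ irr))))

relevant⇒relevant-restrict : (f : BoolFun (suc n)) (i : Fin (suc n)) (j : Fin n) → relevantᵇ f (punchIn i j) ≡ true →
                             ∀ b → Constant (restrict f i b) → relevantᵇ (restrict f i (not b)) j ≡ true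
relevant⇒relevant-restrict f i j rel b const = ≢false⇒≡true λ irr →
  true≢false (trans (sym rel) (irrelevant⇒relevantᵇ≡false f _ (irrelevant-restricts f i j (both irr))))
  where
  both : relevantᵇ (restrict f i (not b)) j ≡ false → ∀ c → Irrelevant (restrict f i c) j
  both irr c with c ≟ᵇ b
  ... | yes refl = constant⇒irrelevant (restrict f i b) const j
  ... | no  c≢b  = subst (λ c → Irrelevant (restrict f i c) j) (sym (¬-not c≢b)) (relevantᵇ≡false⇒irrelevant (restrict f i (not b)) j irr)

KeepsRelevant : BoolFun (suc n) → Fin (suc n) → Bool → Set
KeepsRelevant f i b = ∀ j → relevantᵇ f (punchIn i j) ≡ true → relevantᵇ (restrict f i b) j ≡ true

#relevant-restrict : (f : BoolFun (suc n)) (i : Fin (suc n)) (b : Bool) → KeepsRelevant f i b →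
                     #relevant f ≡ toℕ (relevantᵇ f i) + #relevant (restrict f i b)
#relevant-restrict {n} f i b keeps =
  trans (countFin-punchIn n (relevantᵇ f) i)
        (cong (toℕ (relevantᵇ f i) +_) (countFin-cong n λ j → ≡-by-truth (keeps j) (relevant-restrict⇒relevant f i b j)))

#relevant-restrict-relevant : (f : BoolFun (suc n)) (i : Fin (suc n)) (b : Bool) → relevantᵇ f i ≡ true →
                              KeepsRelevant f i b → #relevant f ≡ suc (#relevant (restrict f i b))
#relevant-restrict-relevant f i b rel keeps =
  trans (#relevant-restrict f i b keeps) (cong (λ r → toℕ r + #relevant (restrict f i b)) rel)

Canalizing : BoolFun n → Fin n → Bool → Set
Canalizing {n} f k c = ∀ (x : Point n) → lookup x k ≡ c → f x ≡ c

ConstantOrCanalizing : BoolFun n → Set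
ConstantOrCanalizing f = Constant f ⊎ ∃ λ k → ∃ λ c → Canalizing f k c

canalizing⇒restrict-constant : {f : BoolFun (suc n)} {k : Fin (suc n)} {c : Bool} →
                               Canalizing f k c → ∀ y → restrict f k c y ≡ c
canalizing⇒restrict-constant {k = k} {c} can y = can _ (insertAt-lookup y k c)

canalizing-irrelevant⇒constant : (f : BoolFun (suc n)) (k : Fin (suc n)) (c : Bool) →
                                 Canalizing f k c → Irrelevant f k → Constant f
canalizing-irrelevant⇒constant f k c can irr =
  c , λ x → trans (irrelevant-reset f x k (irr x) c) (can _ (lookup∘update k x c))

canalizing-#relevant : (f : BoolFun (suc n)) (k : Fin (suc n)) (c : Bool) → Canalizing f k c →
                       relevantᵇ f k ≡ true → #relevant f ≡ suc (#relevant (restrict f k (not c)))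
canalizing-#relevant f k c can rel = #relevant-restrict-relevant f k (not c) rel keeps
  where
  keeps : KeepsRelevant f k (not c)
  keeps j relⱼ = relevant⇒relevant-restrict f k j relⱼ c (c , canalizing⇒restrict-constant can)

restrict-constant⇒canalizing : {f : BoolFun (suc n)} {k : Fin (suc n)} {c : Bool} →
                               (∀ y → restrict f k c y ≡ c) → Canalizing f k c
restrict-constant⇒canalizing {f = f} {k} const x xₖ =
  trans (cong f (trans (sym (insertAt-removeAt x k)) (cong (insertAt (removeAt x k) k) xₖ))) (const _)

suc-+-≤ : ∀ x {a b c} → c ≤ a → 1 ≤ b → suc (x + c) ≤ x + (a + b)
suc-+-≤ x {a} {b} {c} c≤a 1≤b =
  subst (_≤ x + (a + b)) (+-suc x c) (+-monoʳ-≤ x (subst (_≤ a + b) (+-comm c 1) (+-mono-≤ c≤a 1≤b)))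

+-squeeze : ∀ x {a b c} → c ≤ a → 1 ≤ b → x + (a + b) ≤ suc (x + c) → b ≤ 1 × a ≤ c
+-squeeze x {a} {b} {c} c≤a 1≤b le = b≤1 , a≤c
  where
  a+b≤1+c : a + b ≤ suc c
  a+b≤1+c = +-cancelˡ-≤ x _ _ (subst (x + (a + b) ≤_) (sym (+-suc x c)) le)
  b≤1 : b ≤ 1
  b≤1 = +-cancelˡ-≤ a _ _ (≤-trans a+b≤1+c (subst (suc c ≤_) (+-comm 1 a) (s≤s c≤a)))
  a≤c : a ≤ c
  a≤c = s≤s⁻¹ (subst (_≤ suc c) (+-comm a 1) (≤-trans (+-monoʳ-≤ a 1≤b) a+b≤1+c))

+-≤-suc : ∀ x {b} c → b ≤ 1 → x + b ≤ suc (x + c)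
+-≤-suc x {b} c b≤1 = subst (x + b ≤_) (+-suc x c) (+-monoʳ-≤ x (≤-trans b≤1 (s≤s z≤n)))

-- Restricting a positive function along a variable

module Restriction {n : ℕ} (f : BoolFun (suc n)) (pf : Positive f) (i : Fin (suc n)) where

  g h : BoolFun n
  g = restrict f i false
  h = restrict f i true

  g-positive : Positive g
  g-positive = restrict-positive pf i false

  h-positive : Positive h
  h-positive = restrict-positive pf i true

  g≤h : ∀ y → g y ≡ true → h y ≡ true
  g≤h y gy = pf _ _ gy (insertAt-mono i (λ ()) (⪯-refl {x = y}))

  minTrue-at-false : ∀ y → MinTrue f (insertAt y i false) ⇔ MinTrue g y
  minTrue-at-false y = mk⇔
    (λ (fy , min) → fy , λ z z⪯y gz → proj₂ (insertAt-injective i (min _ (insertAt-mono i id z⪯y) gz)))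
    (λ (gy , min) → gy , insertAt-elim i (λ x → x ⪯ insertAt y i false → f x ≡ true → x ≡ insertAt y i false) λ where
      false z z⪯y fz → cong (λ v → insertAt v i false) (min z (insertAt-mono⁻¹ʳ i z⪯y) fz)
      true  z z⪯y _  → ⊥-elim (true≢false (sym (insertAt-mono⁻¹ˡ i z⪯y refl))))

  maxFalse-at-false : ∀ y → MaxFalse f (insertAt y i false) ⇔ (MaxFalse g y × h y ≡ true)
  maxFalse-at-false y = mk⇔
    (λ (fy , max) →
      (fy , λ z y⪯z gz → proj₂ (insertAt-injective i (max _ (insertAt-mono i id y⪯z) gz))) ,
      ≢false⇒≡true λ hy → true≢false (proj₁ (insertAt-injective i (max _ (insertAt-mono i (λ ()) (⪯-refl {x = y})) hy))))
    (λ ((gy , max) , hy) → gy , insertAt-elim i (λ x → insertAt y i false ⪯ x → f x ≡ false → x ≡ insertAt y i false) λ where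
      false z y⪯z fz → cong (λ v → insertAt v i false) (max z (insertAt-mono⁻¹ʳ i y⪯z) fz)
      true  z y⪯z fz → ⊥-elim (true≢false (trans (sym (h-positive y z hy (insertAt-mono⁻¹ʳ i y⪯z))) fz)))

  maxFalse-at-true : ∀ y → MaxFalse f (insertAt y i true) ⇔ MaxFalse h y
  maxFalse-at-true y = mk⇔
    (λ (fy , max) → fy , λ z y⪯z hz → proj₂ (insertAt-injective i (max _ (insertAt-mono i id y⪯z) hz)))
    (λ (hy , max) → hy , insertAt-elim i (λ x → insertAt y i true ⪯ x → f x ≡ false → x ≡ insertAt y i true) λ where
      true  z y⪯z fz → cong (λ v → insertAt v i true) (max z (insertAt-mono⁻¹ʳ i y⪯z) fz)
      false z y⪯z _  → ⊥-elim (true≢false (sym (insertAt-mono⁻¹ˡ i y⪯z refl))))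

  minTrue-at-true : ∀ y → MinTrue f (insertAt y i true) ⇔ (MinTrue h y × g y ≡ false)
  minTrue-at-true y = mk⇔
    (λ (fy , min) →
      (fy , λ z z⪯y hz → proj₂ (insertAt-injective i (min _ (insertAt-mono i id z⪯y) hz))) ,
      ≢true⇒≡false λ gy → true≢false (sym (proj₁ (insertAt-injective i (min _ (insertAt-mono i (λ _ → refl) (⪯-refl {x = y})) gy)))))
    (λ ((hy , min) , gy) → hy , insertAt-elim i (λ x → x ⪯ insertAt y i true → f x ≡ true → x ≡ insertAt y i true) λ where
      true  z z⪯y fz → cong (λ v → insertAt v i true) (min z (insertAt-mono⁻¹ʳ i z⪯y) fz)
      false z z⪯y fz → ⊥-elim (true≢false (trans (sym (g-positive z y fz (insertAt-mono⁻¹ʳ i z⪯y))) gy)))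

  extremal-at-false : ∀ y → extremalᵇ f (insertAt y i false) ≡ minTrueᵇ g y ∨ (maxFalseᵇ g y ∧ h y)
  extremal-at-false y = ≡-by-truth ⇒ ⇐
    where
    ⇒ : extremalᵇ f (insertAt y i false) ≡ true → minTrueᵇ g y ∨ (maxFalseᵇ g y ∧ h y) ≡ true
    ⇒ ex with ∨-elim {maxFalseᵇ f (insertAt y i false)} ex
    ... | inj₁ mf = let (mfg , hy) = Equivalence.to (maxFalse-at-false y) (maxFalseᵇ-sound f _ mf)
                    in ∨-introʳ {minTrueᵇ g y} (∧-intro (maxFalseᵇ-complete g y mfg) hy)
    ... | inj₂ mt = ∨-introˡ (minTrueᵇ-complete g y (Equivalence.to (minTrue-at-false y) (minTrueᵇ-sound f _ mt)))
    ⇐ : minTrueᵇ g y ∨ (maxFalseᵇ g y ∧ h y) ≡ true → extremalᵇ f (insertAt y i false) ≡ true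
    ⇐ ex with ∨-elim {minTrueᵇ g y} ex
    ... | inj₁ mt = ∨-introʳ {maxFalseᵇ f (insertAt y i false)}
                      (minTrueᵇ-complete f _ (Equivalence.from (minTrue-at-false y) (minTrueᵇ-sound g y mt)))
    ... | inj₂ mf∧h = ∨-introˡ (maxFalseᵇ-complete f _ (Equivalence.from (maxFalse-at-false y)
                        (maxFalseᵇ-sound g y (∧-elimˡ mf∧h) , ∧-elimʳ {maxFalseᵇ g y} mf∧h)))

  extremal-at-true : ∀ y → extremalᵇ f (insertAt y i true) ≡ maxFalseᵇ h y ∨ (minTrueᵇ h y ∧ not (g y))
  extremal-at-true y = ≡-by-truth ⇒ ⇐
    where
    ⇒ : extremalᵇ f (insertAt y i true) ≡ true → maxFalseᵇ h y ∨ (minTrueᵇ h y ∧ not (g y)) ≡ true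
    ⇒ ex with ∨-elim {maxFalseᵇ f (insertAt y i true)} ex
    ... | inj₁ mf = ∨-introˡ (maxFalseᵇ-complete h y (Equivalence.to (maxFalse-at-true y) (maxFalseᵇ-sound f _ mf)))
    ... | inj₂ mt = let (mth , gy) = Equivalence.to (minTrue-at-true y) (minTrueᵇ-sound f _ mt)
                    in ∨-introʳ {maxFalseᵇ h y} (∧-intro (minTrueᵇ-complete h y mth) (cong not gy))
    ⇐ : maxFalseᵇ h y ∨ (minTrueᵇ h y ∧ not (g y)) ≡ true → extremalᵇ f (insertAt y i true) ≡ true
    ⇐ ex with ∨-elim {maxFalseᵇ h y} ex
    ... | inj₁ mf = ∨-introˡ (maxFalseᵇ-complete f _ (Equivalence.from (maxFalse-at-true y) (maxFalseᵇ-sound h y mf)))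
    ... | inj₂ mt∧¬g = ∨-introʳ {maxFalseᵇ f (insertAt y i true)} (minTrueᵇ-complete f _ (Equivalence.from (minTrue-at-true y)
                         (minTrueᵇ-sound h y (∧-elimˡ mt∧¬g) , not≡true⇒≡false (∧-elimʳ {minTrueᵇ h y} mt∧¬g))))

  Tg Fh A B C D : ℕ
  Tg = count n (minTrueᵇ g)
  Fh = count n (maxFalseᵇ h)
  A  = count n (λ y → maxFalseᵇ g y ∧ h y)
  B  = count n (λ y → minTrueᵇ h y ∧ not (g y))
  C  = count n (λ y → maxFalseᵇ g y ∧ not (h y))
  D  = count n (λ y → minTrueᵇ h y ∧ g y)

  #extremal-f : #extremal f ≡ (Tg + A) + (Fh + B)
  #extremal-f = trans (count-insertAt n (extremalᵇ f) i) (cong₂ _+_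
    (trans (count-cong n extremal-at-false)
           (count-∨-disjoint n _ _ λ y mt mf∧h → maxFalse-minTrue-disjoint g y (∧-elimˡ mf∧h) mt))
    (trans (count-cong n extremal-at-true)
           (count-∨-disjoint n _ _ λ y mf mt∧¬g → maxFalse-minTrue-disjoint h y mf (∧-elimˡ mt∧¬g))))

  #extremal-g : #extremal g ≡ (Tg + A) + C
  #extremal-g = begin
    #extremal g                ≡⟨ #extremal≡ g ⟩
    count n (maxFalseᵇ g) + Tg ≡⟨ cong (_+ Tg) (count-∧-split n (maxFalseᵇ g) h) ⟩
    (A + C) + Tg               ≡⟨ +-comm (A + C) Tg ⟩
    Tg + (A + C)               ≡⟨ +-assoc Tg A C ⟨
    (Tg + A) + C               ∎
    where open ≡-Reasoning

  #extremal-h : #extremal h ≡ (Fh + B) + D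
  #extremal-h = begin
    #extremal h                ≡⟨ #extremal≡ h ⟩
    Fh + count n (minTrueᵇ h)  ≡⟨ cong (Fh +_) (count-∧-split n (minTrueᵇ h) g) ⟩
    Fh + (D + B)               ≡⟨ cong (Fh +_) (+-comm D B) ⟩
    Fh + (B + D)               ≡⟨ +-assoc Fh B D ⟨
    (Fh + B) + D               ∎
    where open ≡-Reasoning

  maxFalse-g⇒maxFalse-h : ∀ y → MaxFalse g y → h y ≡ false → MaxFalse h y
  maxFalse-g⇒maxFalse-h y (_ , max) hy =
    hy , λ z y⪯z hz → max z y⪯z (≢true⇒≡false λ gz → true≢false (trans (sym (g≤h z gz)) hz))

  minTrue-h⇒minTrue-g : ∀ y → MinTrue h y → g y ≡ true → MinTrue g y
  minTrue-h⇒minTrue-g y (_ , min) gy = gy , λ z z⪯y gz → min z z⪯y (g≤h z gz)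

  C⊆Fh : ∀ y → maxFalseᵇ g y ∧ not (h y) ≡ true → maxFalseᵇ h y ≡ true
  C⊆Fh y c = maxFalseᵇ-complete h y
    (maxFalse-g⇒maxFalse-h y (maxFalseᵇ-sound g y (∧-elimˡ c)) (not≡true⇒≡false (∧-elimʳ {maxFalseᵇ g y} c)))

  D⊆Tg : ∀ y → minTrueᵇ h y ∧ g y ≡ true → minTrueᵇ g y ≡ true
  D⊆Tg y d = minTrueᵇ-complete g y (minTrue-h⇒minTrue-g y (minTrueᵇ-sound h y (∧-elimˡ d)) (∧-elimʳ {minTrueᵇ h y} d))

  relevant⇒separating-point : relevantᵇ f i ≡ true → ∃ λ y → g y ≡ false × h y ≡ true
  relevant⇒separating-point rel with allPoints-false⊎some-true n (λ y → not (g y) ∧ h y)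
  ... | inj₂ (y , sep) = y , not≡true⇒≡false (∧-elimˡ sep) , ∧-elimʳ {not (g y)} sep
  ... | inj₁ none = ⊥-elim (true≢false (trans (sym rel)
                      (irrelevant⇒relevantᵇ≡false f i (restricts-equal⇒irrelevant f i λ y → g≡h y (none y)))))
    where
    g≡h : ∀ y → not (g y) ∧ h y ≡ false → g y ≡ h y
    g≡h y ¬sep = ≡-by-truth (g≤h y) λ hy → ≢false⇒≡true λ gy →
      true≢false (trans (sym (cong₂ _∧_ (cong not gy) hy)) ¬sep)

  1≤A : relevantᵇ f i ≡ true → 1 ≤ A
  1≤A rel = let (y , gy , hy) = relevant⇒separating-point rel
                (w , y⪯w , max) = maxFalse-above g g-positive y gy
            in count-pos n _ w (∧-intro (maxFalseᵇ-complete g w max) (h-positive y w hy y⪯w))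

  1≤B : relevantᵇ f i ≡ true → 1 ≤ B
  1≤B rel = let (y , gy , hy) = relevant⇒separating-point rel
                (w , w⪯y , min) = minTrue-below h h-positive y hy
            in count-pos n _ w (∧-intro (minTrueᵇ-complete h w min) (cong not (positive-false g-positive w⪯y gy)))

  #extremal-f′ : #extremal f ≡ (Fh + B) + (Tg + A)
  #extremal-f′ = trans #extremal-f (+-comm (Tg + A) (Fh + B))

  #extremal-g<f : relevantᵇ f i ≡ true → suc (#extremal g) ≤ #extremal f
  #extremal-g<f rel =
    subst₂ _≤_ (cong suc (sym #extremal-g)) (sym #extremal-f) (suc-+-≤ (Tg + A) (count-mono n C⊆Fh) (1≤B rel))

  #extremal-h<f : relevantᵇ f i ≡ true → suc (#extremal h) ≤ #extremal f
  #extremal-h<f rel =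
    subst₂ _≤_ (cong suc (sym #extremal-h)) (sym #extremal-f′) (suc-+-≤ (Fh + B) (count-mono n D⊆Tg) (1≤A rel))

  g-true⇒f-true : ∀ x → g (removeAt x i) ≡ true → f x ≡ true
  g-true⇒f-true x gx = pf _ _ gx (subst (insertAt (removeAt x i) i false ⪯_) (insertAt-removeAt x i)
                                         (insertAt-mono i (λ ()) (⪯-refl {x = removeAt x i})))

  h-false⇒f-false : ∀ x → h (removeAt x i) ≡ false → f x ≡ false
  h-false⇒f-false x hx = positive-false pf (subst (_⪯ insertAt (removeAt x i) i true) (insertAt-removeAt x i)
                                                   (insertAt-mono i (λ _ → refl) (⪯-refl {x = removeAt x i}))) hx

  ones-except : (k : Fin n) → insertAt (ones n [ k ]≔ false) i true ≡ ones (suc n) [ punchIn i k ]≔ false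
  ones-except k = trans (insertAt-[]≔ (ones n) i true k false) (cong (_[ punchIn i k ]≔ false) (insertAt-replicate i true))

  zeros-except : (k : Fin n) → insertAt (zeros n [ k ]≔ true) i false ≡ zeros (suc n) [ punchIn i k ]≔ true
  zeros-except k = trans (insertAt-[]≔ (zeros n) i false k true) (cong (_[ punchIn i k ]≔ true) (insertAt-replicate i false))

  canalizing-if-h-ones-except : (k : Fin n) → h (ones n [ k ]≔ false) ≡ false → Canalizing f (punchIn i k) false
  canalizing-if-h-ones-except k hz x xₖ =
    positive-false pf (subst (x ⪯_) (sym (ones-except k)) (⪯-[]≔false {x = ones (suc n)} {x} (punchIn i k) (⪯-ones x) xₖ)) hz

  canalizing-if-g-zeros-except : (k : Fin n) → g (zeros n [ k ]≔ true) ≡ true → Canalizing f (punchIn i k) true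
  canalizing-if-g-zeros-except k gz x xₖ =
    pf _ x gz (subst (_⪯ x) (sym (zeros-except k)) ([]≔true-⪯ {x = zeros (suc n)} {x} (punchIn i k) (zeros-⪯ x) xₖ))

  -- Below ones[j := 0] lies a minimal true point w of h with g w = 0, unique by tightness.
  -- Either w = 0, so h ≡ 1 and x_i canalizes f to 1, or any k with w_k = 1 canalizes f to 0.
  canalizing-from-g-canalizing-false :
    (∀ y₁ y₂ → MinTrue h y₁ → g y₁ ≡ false → MinTrue h y₂ → g y₂ ≡ false → y₁ ≡ y₂) →
    (∀ y → MaxFalse h y → MaxFalse g y) →
    (j : Fin n) → Canalizing g j false → h (ones n [ j ]≔ false) ≡ true →
    ∃ λ k → ∃ λ c → Canalizing f k c
  canalizing-from-g-canalizing-false unique maxFalse-h⇒g j canⱼ hy₀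
    with minTrue-below h h-positive (ones n [ j ]≔ false) hy₀
  ... | w , w⪯y₀ , minw with all-false⊎some-true (lookup w)
  ...   | inj₁ w≡0 = i , true , restrict-constant⇒canalizing λ y →
            h-positive w y (minTrue-value minw) λ l wₗ → ⊥-elim (true≢false (trans (sym wₗ) (w≡0 l)))
  ...   | inj₂ (k , wₖ) = punchIn i k , false , canalizing-if-h-ones-except k hz≡false
    where
    y₀ = ones n [ j ]≔ false
    z  = ones n [ k ]≔ false
    z′ = z [ j ]≔ false
    wⱼ : lookup w j ≡ false
    wⱼ = ≢true⇒≡false λ wⱼ → true≢false (trans (sym (w⪯y₀ j wⱼ)) (lookup∘update j (ones n) false))
    k≢j : k ≢ j
    k≢j refl = true≢false (trans (sym wₖ) wⱼ)
    z′ⱼ : lookup z′ j ≡ false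
    z′ⱼ = lookup∘update j z false
    z′ₖ : lookup z′ k ≡ false
    z′ₖ = lookup-[]≔²-inner (ones n) false k≢j
    z′-elsewhere : ∀ l → l ≢ j → l ≢ k → lookup z′ l ≡ true
    z′-elsewhere l l≢j l≢k = trans (lookup-[]≔²-≢ (ones n) false l≢j l≢k) (lookup-replicate l true)
    hz′≡false : h z′ ≡ false
    hz′≡false = ≢true⇒≡false λ hz′ →
      let (w′ , w′⪯z′ , minw′) = minTrue-below h h-positive z′ hz′
          w′ⱼ = ≢true⇒≡false λ w′ⱼ → true≢false (trans (sym (w′⪯z′ j w′ⱼ)) z′ⱼ)
          w′≡w = unique w′ w minw′ (canⱼ w′ w′ⱼ) minw (canⱼ w wⱼ)
      in true≢false (trans (sym (w′⪯z′ k (trans (cong (λ v → lookup v k) w′≡w) wₖ))) z′ₖ)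
    z′[k]≔true : z′ [ k ]≔ true ≡ y₀ [ k ]≔ true
    z′[k]≔true = []≔²-overwrite (ones n) false true k≢j
    hz≡false : h z ≡ false
    hz≡false = ≢true⇒≡false λ hz →
      let maxg = maxFalse-h⇒g z′ (maxFalse-by-flips h-positive hz′≡false (flips hz))
          raised = proj₂ maxg (z′ [ k ]≔ true) (⪯-[]≔true z′ k)
                     (canⱼ _ (trans (lookup∘update-≢ z′ true k≢j) z′ⱼ))
      in true≢false (trans (sym (lookup∘update k z′ true)) (trans (cong (λ v → lookup v k) raised) z′ₖ))
      where
      flips : h z ≡ true → ∀ l → lookup z′ l ≡ false → h (z′ [ l ]≔ true) ≡ true
      flips hz l z′ₗ with l ≟ᶠ j | l ≟ᶠ k
      ... | yes refl | _        = h-positive z _ hz (subst (z ⪯_) (sym ([]≔-idempotent z j)) (⪯-[]≔true z j))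
      ... | no _     | yes refl = h-positive w _ (minTrue-value minw)
                                   (subst (w ⪯_) (sym z′[k]≔true) (⪯-trans {x = w} {y₀} {y₀ [ k ]≔ true} w⪯y₀ (⪯-[]≔true y₀ k)))
      ... | no l≢j   | no l≢k   = ⊥-elim (true≢false (trans (sym (z′-elsewhere l l≢j l≢k)) z′ₗ))

  canalizing-from-h-canalizing-true :
    (∀ y₁ y₂ → MaxFalse g y₁ → h y₁ ≡ true → MaxFalse g y₂ → h y₂ ≡ true → y₁ ≡ y₂) →
    (∀ y → MinTrue g y → MinTrue h y) →
    (j : Fin n) → Canalizing h j true → g (zeros n [ j ]≔ true) ≡ false →
    ∃ λ k → ∃ λ c → Canalizing f k c
  canalizing-from-h-canalizing-true unique minTrue-g⇒h j canⱼ gy₀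
    with maxFalse-above g g-positive (zeros n [ j ]≔ true) gy₀
  ... | w , y₀⪯w , maxw with all-false⊎some-true (not ∘ lookup w)
  ...   | inj₁ w≡1 = i , false , restrict-constant⇒canalizing λ y →
            positive-false g-positive (λ l _ → trans (sym (not-involutive (lookup w l))) (cong not (w≡1 l)))
                           (maxFalse-value maxw)
  ...   | inj₂ (k , ¬wₖ) = punchIn i k , true , canalizing-if-g-zeros-except k gz≡true
    where
    y₀ = zeros n [ j ]≔ true
    z  = zeros n [ k ]≔ true
    z′ = z [ j ]≔ true
    wₖ : lookup w k ≡ false
    wₖ = not≡true⇒≡false ¬wₖ
    wⱼ : lookup w j ≡ true
    wⱼ = y₀⪯w j (lookup∘update j (zeros n) true)
    k≢j : k ≢ j
    k≢j refl = true≢false (trans (sym wⱼ) wₖ)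
    z′ⱼ : lookup z′ j ≡ true
    z′ⱼ = lookup∘update j z true
    z′ₖ : lookup z′ k ≡ true
    z′ₖ = lookup-[]≔²-inner (zeros n) true k≢j
    z′-elsewhere : ∀ l → l ≢ j → l ≢ k → lookup z′ l ≡ false
    z′-elsewhere l l≢j l≢k = trans (lookup-[]≔²-≢ (zeros n) true l≢j l≢k) (lookup-replicate l false)
    gz′≡true : g z′ ≡ true
    gz′≡true = ≢false⇒≡true λ gz′ →
      let (w′ , z′⪯w′ , maxw′) = maxFalse-above g g-positive z′ gz′
          w′≡w = unique w′ w maxw′ (canⱼ w′ (z′⪯w′ j z′ⱼ)) maxw (canⱼ w wⱼ)
      in true≢false (trans (sym (z′⪯w′ k z′ₖ)) (trans (cong (λ v → lookup v k) w′≡w) wₖ))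
    z′[k]≔false : z′ [ k ]≔ false ≡ y₀ [ k ]≔ false
    z′[k]≔false = []≔²-overwrite (zeros n) true false k≢j
    gz≡true : g z ≡ true
    gz≡true = ≢false⇒≡true λ gz →
      let minh = minTrue-g⇒h z′ (minTrue-by-flips g-positive gz′≡true (flips gz))
          lowered = proj₂ minh (z′ [ k ]≔ false) ([]≔false-⪯ z′ k)
                      (canⱼ _ (trans (lookup∘update-≢ z′ false k≢j) z′ⱼ))
      in true≢false (trans (sym z′ₖ) (trans (cong (λ v → lookup v k) (sym lowered)) (lookup∘update k z′ false)))
      where
      flips : g z ≡ false → ∀ l → lookup z′ l ≡ true → g (z′ [ l ]≔ false) ≡ false
      flips gz l z′ₗ with l ≟ᶠ j | l ≟ᶠ k
      ... | yes refl | _        = positive-false g-positive (subst (_⪯ z) (sym ([]≔-idempotent z j)) ([]≔false-⪯ z j)) gz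
      ... | no _     | yes refl = positive-false g-positive
                                   (subst (_⪯ w) (sym z′[k]≔false) (⪯-trans {x = y₀ [ k ]≔ false} {y₀} {w} ([]≔false-⪯ y₀ k) y₀⪯w))
                                   (maxFalse-value maxw)
      ... | no l≢j   | no l≢k   = ⊥-elim (true≢false (trans (sym z′ₗ) (z′-elsewhere l l≢j l≢k)))

  tight-g⇒canalizing : relevantᵇ f i ≡ true → #extremal f ≤ suc (#extremal g) →
                       ConstantOrCanalizing g → ConstantOrCanalizing f
  tight-g⇒canalizing _ _ (inj₁ (false , g≡0)) = inj₂ (i , false , restrict-constant⇒canalizing g≡0)
  tight-g⇒canalizing _ _ (inj₁ (true , g≡1)) = inj₁ (true , λ x → g-true⇒f-true x (g≡1 _))
  tight-g⇒canalizing _ _ (inj₂ (j , true , canⱼ)) =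
    inj₂ (punchIn i j , true , λ x xⱼ → g-true⇒f-true x (canⱼ _ (trans (lookup-removeAt x i j) xⱼ)))
  tight-g⇒canalizing rel tight (inj₂ (j , false , canⱼ)) with h (ones n [ j ]≔ false) in hy₀
  ... | false = inj₂ (punchIn i j , false , canalizing-if-h-ones-except j hy₀)
  ... | true  = inj₂ (canalizing-from-g-canalizing-false unique maxFalse-h⇒g j canⱼ hy₀)
    where
    B≤1×Fh≤C : B ≤ 1 × Fh ≤ C
    B≤1×Fh≤C = +-squeeze (Tg + A) (count-mono n C⊆Fh) (1≤B rel) (subst₂ _≤_ #extremal-f (cong suc #extremal-g) tight)
    unique : ∀ y₁ y₂ → MinTrue h y₁ → g y₁ ≡ false → MinTrue h y₂ → g y₂ ≡ false → y₁ ≡ y₂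
    unique y₁ y₂ min₁ g₁ min₂ g₂ = count≤1⇒unique n _ (proj₁ B≤1×Fh≤C) y₁ y₂
      (∧-intro (minTrueᵇ-complete h y₁ min₁) (cong not g₁)) (∧-intro (minTrueᵇ-complete h y₂ min₂) (cong not g₂))
    maxFalse-h⇒g : ∀ y → MaxFalse h y → MaxFalse g y
    maxFalse-h⇒g y max = maxFalseᵇ-sound g y
      (∧-elimˡ (count-⊆-≥⇒⊇ n _ (maxFalseᵇ h) C⊆Fh (proj₂ B≤1×Fh≤C) y (maxFalseᵇ-complete h y max)))

  tight-h⇒canalizing : relevantᵇ f i ≡ true → #extremal f ≤ suc (#extremal h) →
                       ConstantOrCanalizing h → ConstantOrCanalizing f
  tight-h⇒canalizing _ _ (inj₁ (true , h≡1)) = inj₂ (i , true , restrict-constant⇒canalizing h≡1)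
  tight-h⇒canalizing _ _ (inj₁ (false , h≡0)) = inj₁ (false , λ x → h-false⇒f-false x (h≡0 _))
  tight-h⇒canalizing _ _ (inj₂ (j , false , canⱼ)) =
    inj₂ (punchIn i j , false , λ x xⱼ → h-false⇒f-false x (canⱼ _ (trans (lookup-removeAt x i j) xⱼ)))
  tight-h⇒canalizing rel tight (inj₂ (j , true , canⱼ)) with g (zeros n [ j ]≔ true) in gy₀
  ... | true  = inj₂ (punchIn i j , true , canalizing-if-g-zeros-except j gy₀)
  ... | false = inj₂ (canalizing-from-h-canalizing-true unique minTrue-g⇒h j canⱼ gy₀)
    where
    A≤1×Tg≤D : A ≤ 1 × Tg ≤ D
    A≤1×Tg≤D = +-squeeze (Fh + B) (count-mono n D⊆Tg) (1≤A rel) (subst₂ _≤_ #extremal-f′ (cong suc #extremal-h) tight)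
    unique : ∀ y₁ y₂ → MaxFalse g y₁ → h y₁ ≡ true → MaxFalse g y₂ → h y₂ ≡ true → y₁ ≡ y₂
    unique y₁ y₂ max₁ h₁ max₂ h₂ = count≤1⇒unique n _ (proj₁ A≤1×Tg≤D) y₁ y₂
      (∧-intro (maxFalseᵇ-complete g y₁ max₁) h₁) (∧-intro (maxFalseᵇ-complete g y₂ max₂) h₂)
    minTrue-g⇒h : ∀ y → MinTrue g y → MinTrue h y
    minTrue-g⇒h y min = minTrueᵇ-sound h y
      (∧-elimˡ (count-⊆-≥⇒⊇ n _ (minTrueᵇ g) D⊆Tg (proj₂ A≤1×Tg≤D) y (minTrueᵇ-complete g y min)))

  restrict<f : relevantᵇ f i ≡ true → ∀ b → suc (#extremal (restrict f i b)) ≤ #extremal f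
  restrict<f rel false = #extremal-g<f rel
  restrict<f rel true  = #extremal-h<f rel

  tight-restrict⇒canalizing : relevantᵇ f i ≡ true → ∀ b → #extremal f ≤ suc (#extremal (restrict f i b)) →
                              ConstantOrCanalizing (restrict f i b) → ConstantOrCanalizing f
  tight-restrict⇒canalizing rel false = tight-g⇒canalizing rel
  tight-restrict⇒canalizing rel true  = tight-h⇒canalizing rel

  restrict-constant⇒#extremal≤ : ∀ c → (∀ y → restrict f i c y ≡ c) → #extremal f ≤ suc (#extremal (restrict f i (not c)))
  restrict-constant⇒#extremal≤ true h≡1 =
    subst₂ _≤_ (sym #extremal-f) (cong suc (sym #extremal-g))
      (subst (λ fh → (Tg + A) + (fh + B) ≤ suc ((Tg + A) + C)) (sym Fh≡0) (+-≤-suc (Tg + A) C B≤1))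
    where
    Fh≡0 : Fh ≡ 0
    Fh≡0 = count-none n λ y mf → true≢false (trans (sym (h≡1 y)) (maxFalse-value (maxFalseᵇ-sound h y mf)))
    B≤1 : B ≤ 1
    B≤1 = unique⇒count≤1 n _ (zeros n) λ y b →
      sym (proj₂ (minTrueᵇ-sound h y (∧-elimˡ b)) (zeros n) (zeros-⪯ y) (h≡1 _))
  restrict-constant⇒#extremal≤ false g≡0 =
    subst₂ _≤_ (sym #extremal-f′) (cong suc (sym #extremal-h))
      (subst (λ tg → (Fh + B) + (tg + A) ≤ suc ((Fh + B) + D)) (sym Tg≡0) (+-≤-suc (Fh + B) D A≤1))
    where
    Tg≡0 : Tg ≡ 0
    Tg≡0 = count-none n λ y mt → true≢false (trans (sym (minTrue-value (minTrueᵇ-sound g y mt))) (g≡0 y))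
    A≤1 : A ≤ 1
    A≤1 = unique⇒count≤1 n _ (ones n) λ y a →
      sym (proj₂ (maxFalseᵇ-sound g y (∧-elimˡ a)) (ones n) (⪯-ones y) (g≡0 _))

-- A variable whose restriction keeps the others relevant

irrelevant-on-hyperplane : (f : BoolFun (suc n)) (i : Fin (suc n)) (b : Bool) (j : Fin n) →
                           Irrelevant (restrict f i b) j →
                           ∀ x → f ((x [ i ]≔ b) [ punchIn i j ]≔ false) ≡ f ((x [ i ]≔ b) [ punchIn i j ]≔ true)
irrelevant-on-hyperplane f i b j irr x = begin
  f ((x [ i ]≔ b) [ punchIn i j ]≔ false)                    ≡⟨ cong (λ v → f (v [ punchIn i j ]≔ false)) ([]≔-insertAt-removeAt x i b) ⟩
  f (insertAt (removeAt x i) i b [ punchIn i j ]≔ false)      ≡⟨ cong f (insertAt-[]≔ (removeAt x i) i b j false) ⟨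
  f (insertAt (removeAt x i [ j ]≔ false) i b)                ≡⟨ irr (removeAt x i) ⟩
  f (insertAt (removeAt x i [ j ]≔ true) i b)                 ≡⟨ cong f (insertAt-[]≔ (removeAt x i) i b j true) ⟩
  f (insertAt (removeAt x i) i b [ punchIn i j ]≔ true)       ≡⟨ cong (λ v → f (v [ punchIn i j ]≔ true)) ([]≔-insertAt-removeAt x i b) ⟨
  f ((x [ i ]≔ b) [ punchIn i j ]≔ true)                     ∎
  where open ≡-Reasoning

module SplittingVariable {n : ℕ} (f : BoolFun (suc n)) (pf : Positive f) where

  critical : Fin (suc n) → Point (suc n) → Bool
  critical k x = f x ∧ not (f (x [ k ]≔ false))

  influence : Fin (suc n) → ℕ
  influence k = count (suc n) (critical k)

  least-influence : ∀ m k → influence k ≤ m → relevantᵇ f k ≡ true →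
                    ∃ λ i → relevantᵇ f i ≡ true × (∀ j → relevantᵇ f j ≡ true → influence i ≤ influence j)
  least-influence m k bound relₖ with all-false⊎some-true (λ j → relevantᵇ f j ∧ does (influence j <? influence k))
  ... | inj₁ none = k , relₖ , λ j relⱼ → ≮⇒≥ λ lt →
          true≢false (trans (sym (∧-intro relⱼ (dec-true (influence j <? influence k) lt))) (none j))
  ... | inj₂ (j , better) with m | ≤-trans (does≡true⇒ (influence j <? influence k) (∧-elimʳ {relevantᵇ f j} better)) bound
  ...   | suc m′ | s≤s lt = least-influence m′ j lt (∧-elimˡ better)

  -- If i has least influence and the restriction x_i = 0 loses the relevant variable j′,
  -- then the critical points of i and j′ coincide; so i is irrelevant when x_j′ = 0, and
  -- the restriction x_i = 1 loses nothing.
  module _ (i : Fin (suc n)) (least : ∀ k → relevantᵇ f k ≡ true → influence i ≤ influence k)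
           (j : Fin n) (relⱼ : relevantᵇ f (punchIn i j) ≡ true) (irrⱼ : Irrelevant (restrict f i false) j) where

    private
      j′ = punchIn i j

      i≢j′ : i ≢ j′
      i≢j′ i≡j′ = punchInᵢ≢i i j (sym i≡j′)

      j′-free-at-i-false : ∀ x → f ((x [ i ]≔ false) [ j′ ]≔ false) ≡ f ((x [ i ]≔ false) [ j′ ]≔ true)
      j′-free-at-i-false = irrelevant-on-hyperplane f i false j irrⱼ

    critical-j′⇒critical-i : ∀ x → critical j′ x ≡ true → critical i x ≡ true
    critical-j′⇒critical-i x crit = ∧-intro (∧-elimˡ crit) (cong not fx[i]≔false)
      where
      fx[j′]≔false : f (x [ j′ ]≔ false) ≡ false
      fx[j′]≔false = not≡true⇒≡false (∧-elimʳ {f x} crit)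
      both-off : f ((x [ i ]≔ false) [ j′ ]≔ false) ≡ false
      both-off = positive-false pf ([]≔-mono {x = x [ i ]≔ false} {x} j′ false ([]≔false-⪯ x i)) fx[j′]≔false
      fx[i]≔false : f (x [ i ]≔ false) ≡ false
      fx[i]≔false = positive-false pf (⪯-[]≔true (x [ i ]≔ false) j′) (trans (sym (j′-free-at-i-false x)) both-off)

    critical-i⇒critical-j′ : ∀ x → critical i x ≡ true → critical j′ x ≡ true
    critical-i⇒critical-j′ = count-⊆-≥⇒⊇ (suc n) (critical j′) (critical i) critical-j′⇒critical-i (least j′ relⱼ)

    i-free-at-j′-false : ∀ x → f ((x [ j′ ]≔ false) [ i ]≔ false) ≡ f ((x [ j′ ]≔ false) [ i ]≔ true)
    i-free-at-j′-false x = ≡-by-truth (λ fy → pf _ _ fy (λ k yₖ → ⪯-[]≔true x₀ i k ([]≔false-⪯ x₀ i k yₖ))) lower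
      where
      x₀ = x [ j′ ]≔ false
      y  = x₀ [ i ]≔ true
      y[j′]≔false : y [ j′ ]≔ false ≡ y
      y[j′]≔false = []≔-lookup-≡ y j′ (trans (lookup∘update-≢ x₀ true i≢j′) (lookup∘update j′ x false))
      lower : f y ≡ true → f (x₀ [ i ]≔ false) ≡ true
      lower fy = ≢false⇒≡true λ fy[i]≔false →
        let crit = critical-i⇒critical-j′ y (∧-intro fy (cong not (trans (cong f ([]≔-idempotent x₀ i)) fy[i]≔false)))
        in true≢false (trans (sym fy) (trans (cong f (sym y[j′]≔false)) (not≡true⇒≡false (∧-elimʳ {f y} crit))))

    keeps-true : KeepsRelevant f i true
    keeps-true k relₖ′ = ≢false⇒≡true λ irrₖ → true≢false (trans (sym relₖ′)
      (irrelevant⇒relevantᵇ≡false f k′ (irrelevant (irrelevant-on-hyperplane f i true k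
        (relevantᵇ≡false⇒irrelevant (restrict f i true) k irrₖ)))))
      where
      k′ = punchIn i k
      i≢k′ : i ≢ k′
      i≢k′ i≡k′ = punchInᵢ≢i i k (sym i≡k′)
      irrelevant : (∀ x → f ((x [ i ]≔ true) [ k′ ]≔ false) ≡ f ((x [ i ]≔ true) [ k′ ]≔ true)) → Irrelevant f k′
      irrelevant free x with lookup x i in xᵢ | k′ ≟ᶠ j′
      ... | true  | _        = subst (λ v → f (v [ k′ ]≔ false) ≡ f (v [ k′ ]≔ true)) ([]≔-lookup-≡ x i xᵢ) (free x)
      ... | false | yes k′≡j′ = subst (λ u → f (x [ u ]≔ false) ≡ f (x [ u ]≔ true)) (sym k′≡j′)
                                 (subst (λ v → f (v [ j′ ]≔ false) ≡ f (v [ j′ ]≔ true)) ([]≔-lookup-≡ x i xᵢ) (j′-free-at-i-false x))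
      ... | false | no k′≢j′ = trans (via-i-true false) (trans (free (x [ j′ ]≔ false)) (sym (via-i-true true)))
        where
        via-i-true : ∀ v → f (x [ k′ ]≔ v) ≡ f (((x [ j′ ]≔ false) [ i ]≔ true) [ k′ ]≔ v)
        via-i-true v = begin
          f z                                        ≡⟨ cong f ([]≔-lookup-≡ z i (trans (lookup∘update-≢ x v (i≢k′ ∘ sym)) xᵢ)) ⟨
          f (z [ i ]≔ false)                         ≡⟨ irrelevant-reset f (z [ i ]≔ false) j′ (j′-free-at-i-false z) false ⟩
          f ((z [ i ]≔ false) [ j′ ]≔ false)         ≡⟨ cong f ([]≔-commutes z i j′ i≢j′) ⟩
          f ((z [ j′ ]≔ false) [ i ]≔ false)         ≡⟨ i-free-at-j′-false z ⟩
          f ((z [ j′ ]≔ false) [ i ]≔ true)          ≡⟨ cong (λ u → f (u [ i ]≔ true)) ([]≔-commutes x k′ j′ k′≢j′) ⟩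
          f (((x [ j′ ]≔ false) [ k′ ]≔ v) [ i ]≔ true) ≡⟨ cong f ([]≔-commutes (x [ j′ ]≔ false) k′ i (i≢k′ ∘ sym)) ⟩
          f (((x [ j′ ]≔ false) [ i ]≔ true) [ k′ ]≔ v) ∎
          where
          open ≡-Reasoning
          z = x [ k′ ]≔ v

  splitting-variable : ∀ k → relevantᵇ f k ≡ true → ∃ λ i → relevantᵇ f i ≡ true × ∃ (KeepsRelevant f i)
  splitting-variable k relₖ with least-influence (influence k) k ≤-refl relₖ
  ... | i , relᵢ , least with all-false⊎some-true (λ j → relevantᵇ f (punchIn i j) ∧ not (relevantᵇ (restrict f i false) j))
  ...   | inj₁ none = i , relᵢ , false , λ j relⱼ → ≢false⇒≡true λ lost →
            true≢false (trans (sym (∧-intro relⱼ (cong not lost))) (none j))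
  ...   | inj₂ (j , lost) = i , relᵢ , true , keeps-true i least j (∧-elimˡ lost)
            (relevantᵇ≡false⇒irrelevant (restrict f i false) j (not≡true⇒≡false (∧-elimʳ {relevantᵇ f (punchIn i j)} lost)))

-- Linear read-once functions

strengthenLit : (k : Fin (suc n)) (l : Lit (suc n)) → litVar l ≢ k → Lit n
strengthenLit k (pos v) v≢k = pos (punchOut (v≢k ∘ sym))
strengthenLit k (neg v) v≢k = neg (punchOut (v≢k ∘ sym))

strengthenLit-var : (k : Fin (suc n)) (l : Lit (suc n)) (v≢k : litVar l ≢ k) →
                    punchIn k (litVar (strengthenLit k l v≢k)) ≡ litVar l
strengthenLit-var k (pos v) v≢k = punchIn-punchOut _
strengthenLit-var k (neg v) v≢k = punchIn-punchOut _

strengthenLit-eval : (k : Fin (suc n)) (l : Lit (suc n)) (v≢k : litVar l ≢ k) (b : Bool) (y : Point n) →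
                     evalLit (strengthenLit k l v≢k) y ≡ evalLit l (insertAt y k b)
strengthenLit-eval k (pos v) v≢k b y =
  trans (sym (insertAt-punchIn y k b _)) (cong (lookup (insertAt y k b)) (punchIn-punchOut _))
strengthenLit-eval k (neg v) v≢k b y =
  cong not (trans (sym (insertAt-punchIn y k b _)) (cong (lookup (insertAt y k b)) (punchIn-punchOut _)))

strengthen : (k : Fin (suc n)) (t : Nested (suc n)) → ¬ Occurs k t → Nested n
strengthen k (lit l)  k∉t = lit (strengthenLit k l (k∉t ∘ here-lit))
strengthen k (l ∨ₙ t) k∉t = strengthenLit k l (k∉t ∘ here-∨) ∨ₙ strengthen k t (k∉t ∘ there-∨)
strengthen k (l ∧ₙ t) k∉t = strengthenLit k l (k∉t ∘ here-∧) ∧ₙ strengthen k t (k∉t ∘ there-∧)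

strengthen-eval : (k : Fin (suc n)) (t : Nested (suc n)) (k∉t : ¬ Occurs k t) (b : Bool) (y : Point n) →
                  eval (strengthen k t k∉t) y ≡ eval t (insertAt y k b)
strengthen-eval k (lit l)  k∉t b y = strengthenLit-eval k l _ b y
strengthen-eval k (l ∨ₙ t) k∉t b y = cong₂ _∨_ (strengthenLit-eval k l _ b y) (strengthen-eval k t _ b y)
strengthen-eval k (l ∧ₙ t) k∉t b y = cong₂ _∧_ (strengthenLit-eval k l _ b y) (strengthen-eval k t _ b y)

strengthen-occurs : (k : Fin (suc n)) (t : Nested (suc n)) (k∉t : ¬ Occurs k t) (u : Fin n) →
                    Occurs u (strengthen k t k∉t) → Occurs (punchIn k u) t
strengthen-occurs k (lit l)  _ u (here-lit e) = here-lit (trans (sym (strengthenLit-var k l _)) (cong (punchIn k) e))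
strengthen-occurs k (l ∨ₙ t) _ u (here-∨ e)   = here-∨ (trans (sym (strengthenLit-var k l _)) (cong (punchIn k) e))
strengthen-occurs k (l ∨ₙ t) _ u (there-∨ o)  = there-∨ (strengthen-occurs k t _ u o)
strengthen-occurs k (l ∧ₙ t) _ u (here-∧ e)   = here-∧ (trans (sym (strengthenLit-var k l _)) (cong (punchIn k) e))
strengthen-occurs k (l ∧ₙ t) _ u (there-∧ o)  = there-∧ (strengthen-occurs k t _ u o)

strengthen-wellFormed : (k : Fin (suc n)) (t : Nested (suc n)) (k∉t : ¬ Occurs k t) →
                        WellFormed t → WellFormed (strengthen k t k∉t)
strengthen-wellFormed k (lit l)  _ _ = tt
strengthen-wellFormed k (l ∨ₙ t) _ (l∉t , wf) =
  (λ o → l∉t (subst (λ v → Occurs v t) (strengthenLit-var k l _) (strengthen-occurs k t _ _ o))) ,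
  strengthen-wellFormed k t _ wf
strengthen-wellFormed k (l ∧ₙ t) _ (l∉t , wf) =
  (λ o → l∉t (subst (λ v → Occurs v t) (strengthenLit-var k l _) (strengthen-occurs k t _ _ o))) ,
  strengthen-wellFormed k t _ wf

weakenLit : Fin (suc n) → Lit n → Lit (suc n)
weakenLit k (pos v) = pos (punchIn k v)
weakenLit k (neg v) = neg (punchIn k v)

weaken : Fin (suc n) → Nested n → Nested (suc n)
weaken k (lit l)  = lit (weakenLit k l)
weaken k (l ∨ₙ t) = weakenLit k l ∨ₙ weaken k t
weaken k (l ∧ₙ t) = weakenLit k l ∧ₙ weaken k t

weakenLit-var : (k : Fin (suc n)) (l : Lit n) → litVar (weakenLit k l) ≡ punchIn k (litVar l)
weakenLit-var k (pos v) = refl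
weakenLit-var k (neg v) = refl

weakenLit-eval : (k : Fin (suc n)) (l : Lit n) (b : Bool) (y : Point n) → evalLit (weakenLit k l) (insertAt y k b) ≡ evalLit l y
weakenLit-eval k (pos v) b y = insertAt-punchIn y k b v
weakenLit-eval k (neg v) b y = cong not (insertAt-punchIn y k b v)

weaken-eval : (k : Fin (suc n)) (t : Nested n) (b : Bool) (y : Point n) → eval (weaken k t) (insertAt y k b) ≡ eval t y
weaken-eval k (lit l)  b y = weakenLit-eval k l b y
weaken-eval k (l ∨ₙ t) b y = cong₂ _∨_ (weakenLit-eval k l b y) (weaken-eval k t b y)
weaken-eval k (l ∧ₙ t) b y = cong₂ _∧_ (weakenLit-eval k l b y) (weaken-eval k t b y)

weaken-occurs : (k : Fin (suc n)) (t : Nested n) (u : Fin (suc n)) →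
                Occurs u (weaken k t) → ∃ λ v → u ≡ punchIn k v × Occurs v t
weaken-occurs k (lit l)  u (here-lit e) = litVar l , trans (sym e) (weakenLit-var k l) , here-lit refl
weaken-occurs k (l ∨ₙ t) u (here-∨ e)   = litVar l , trans (sym e) (weakenLit-var k l) , here-∨ refl
weaken-occurs k (l ∨ₙ t) u (there-∨ o)  = let (v , e , o′) = weaken-occurs k t u o in v , e , there-∨ o′
weaken-occurs k (l ∧ₙ t) u (here-∧ e)   = litVar l , trans (sym e) (weakenLit-var k l) , here-∧ refl
weaken-occurs k (l ∧ₙ t) u (there-∧ o)  = let (v , e , o′) = weaken-occurs k t u o in v , e , there-∧ o′

weaken-fresh : (k : Fin (suc n)) (t : Nested n) → ¬ Occurs k (weaken k t)
weaken-fresh k t o = let (v , k≡v′ , _) = weaken-occurs k t k o in punchInᵢ≢i k v (sym k≡v′)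

weakenLit-fresh : (k : Fin (suc n)) (l : Lit n) (t : Nested n) →
                  ¬ Occurs (litVar l) t → ¬ Occurs (litVar (weakenLit k l)) (weaken k t)
weakenLit-fresh k l t l∉t o = let (v , e , o′) = weaken-occurs k t _ o in
  l∉t (subst (λ w → Occurs w t) (sym (punchIn-injective k _ _ (trans (sym (weakenLit-var k l)) e))) o′)

weaken-wellFormed : (k : Fin (suc n)) (t : Nested n) → WellFormed t → WellFormed (weaken k t)
weaken-wellFormed k (lit l)  _ = tt
weaken-wellFormed k (l ∨ₙ t) (l∉t , wf) = weakenLit-fresh k l t l∉t , weaken-wellFormed k t wf
weaken-wellFormed k (l ∧ₙ t) (l∉t , wf) = weakenLit-fresh k l t l∉t , weaken-wellFormed k t wf

positive-true-at-0⇒constant : {f : BoolFun n} → Positive f → (k : Fin n) →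
                              (∀ x → lookup x k ≡ false → f x ≡ true) → Constant f
positive-true-at-0⇒constant pf k true-at-0 =
  true , λ x → pf (x [ k ]≔ false) x (true-at-0 _ (lookup∘update k x false)) ([]≔false-⪯ x k)

positive-false-at-1⇒constant : {f : BoolFun n} → Positive f → (k : Fin n) →
                               (∀ x → lookup x k ≡ true → f x ≡ false) → Constant f
positive-false-at-1⇒constant pf k false-at-1 =
  false , λ x → positive-false pf {x} {x [ k ]≔ true} (⪯-[]≔true x k) (false-at-1 _ (lookup∘update k x true))

linearReadOnce-split : (f : BoolFun (suc n)) → Positive f → LinearReadOnce f →
                       Constant f ⊎ ∃ λ k → ∃ λ c → Canalizing f k c × LinearReadOnce (restrict f k (not c))
linearReadOnce-split f pf (inj₁ const) = inj₁ const
linearReadOnce-split f pf (inj₂ (lit (pos k) , _ , f≗t)) =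
  inj₂ (k , true , (λ x xₖ → trans (f≗t x) xₖ) , inj₁ (false , λ y → trans (f≗t _) (insertAt-lookup y k false)))
linearReadOnce-split f pf (inj₂ (lit (neg k) , _ , f≗t)) =
  inj₁ (positive-true-at-0⇒constant pf k λ x xₖ → trans (f≗t x) (cong not xₖ))
linearReadOnce-split f pf (inj₂ (pos k ∨ₙ t , (k∉t , wf) , f≗t)) =
  inj₂ (k , true , (λ x xₖ → trans (f≗t x) (cong (_∨ eval t x) xₖ)) ,
        inj₂ (strengthen k t k∉t , strengthen-wellFormed k t k∉t wf , λ y →
          trans (f≗t _) (trans (cong (_∨ eval t (insertAt y k false)) (insertAt-lookup y k false))
                               (sym (strengthen-eval k t k∉t false y)))))
linearReadOnce-split f pf (inj₂ (neg k ∨ₙ t , _ , f≗t)) =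
  inj₁ (positive-true-at-0⇒constant pf k λ x xₖ → trans (f≗t x) (cong (λ v → not v ∨ eval t x) xₖ))
linearReadOnce-split f pf (inj₂ (pos k ∧ₙ t , (k∉t , wf) , f≗t)) =
  inj₂ (k , false , (λ x xₖ → trans (f≗t x) (cong (_∧ eval t x) xₖ)) ,
        inj₂ (strengthen k t k∉t , strengthen-wellFormed k t k∉t wf , λ y →
          trans (f≗t _) (trans (cong (_∧ eval t (insertAt y k true)) (insertAt-lookup y k true))
                               (sym (strengthen-eval k t k∉t true y)))))
linearReadOnce-split f pf (inj₂ (neg k ∧ₙ t , _ , f≗t)) =
  inj₁ (positive-false-at-1⇒constant pf k λ x xₖ → trans (f≗t x) (cong (λ v → not v ∧ eval t x) xₖ))

linearReadOnce⇒constantOrCanalizing : (f : BoolFun n) → Positive f → LinearReadOnce f → ConstantOrCanalizing f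
linearReadOnce⇒constantOrCanalizing {zero}  f _  _ = inj₁ (f [] , λ { [] → refl })
linearReadOnce⇒constantOrCanalizing {suc n} f pf lro with linearReadOnce-split f pf lro
... | inj₁ const              = inj₁ const
... | inj₂ (k , c , can , _)  = inj₂ (k , c , can)

by-hyperplanes : (f φ : BoolFun (suc n)) (k : Fin (suc n)) →
                 (∀ b y → f (insertAt y k b) ≡ φ (insertAt y k b)) → ∀ x → f x ≡ φ x
by-hyperplanes f φ k = insertAt-elim k (λ x → f x ≡ φ x)

canalizing-linearReadOnce : (f : BoolFun (suc n)) (k : Fin (suc n)) (c : Bool) → Canalizing f k c →
                            LinearReadOnce (restrict f k (not c)) → LinearReadOnce f
canalizing-linearReadOnce f k true can (inj₁ (true , r≡1)) = inj₁ (true , by-hyperplanes f _ k λ where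
  true  y → canalizing⇒restrict-constant can y
  false y → r≡1 y)
canalizing-linearReadOnce f k true can (inj₁ (false , r≡0)) = inj₂ (lit (pos k) , tt , by-hyperplanes f _ k λ where
  true  y → trans (canalizing⇒restrict-constant can y) (sym (insertAt-lookup y k true))
  false y → trans (r≡0 y) (sym (insertAt-lookup y k false)))
canalizing-linearReadOnce f k false can (inj₁ (false , r≡0)) = inj₁ (false , by-hyperplanes f _ k λ where
  true  y → r≡0 y
  false y → canalizing⇒restrict-constant can y)
canalizing-linearReadOnce f k false can (inj₁ (true , r≡1)) = inj₂ (lit (pos k) , tt , by-hyperplanes f _ k λ where
  true  y → trans (r≡1 y) (sym (insertAt-lookup y k true))
  false y → trans (canalizing⇒restrict-constant can y) (sym (insertAt-lookup y k false)))
canalizing-linearReadOnce f k true can (inj₂ (t , wf , r≗t)) =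
  inj₂ (pos k ∨ₙ weaken k t , (weaken-fresh k t , weaken-wellFormed k t wf) , by-hyperplanes f _ k λ where
    true  y → trans (canalizing⇒restrict-constant can y)
                    (cong (_∨ eval (weaken k t) (insertAt y k true)) (sym (insertAt-lookup y k true)))
    false y → trans (r≗t y) (trans (sym (weaken-eval k t false y))
                    (cong (_∨ eval (weaken k t) (insertAt y k false)) (sym (insertAt-lookup y k false)))))
canalizing-linearReadOnce f k false can (inj₂ (t , wf , r≗t)) =
  inj₂ (pos k ∧ₙ weaken k t , (weaken-fresh k t , weaken-wellFormed k t wf) , by-hyperplanes f _ k λ where
    false y → trans (canalizing⇒restrict-constant can y)
                    (cong (_∧ eval (weaken k t) (insertAt y k false)) (sym (insertAt-lookup y k false)))
    true  y → trans (r≗t y) (trans (sym (weaken-eval k t true y))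
                    (cong (_∧ eval (weaken k t) (insertAt y k true)) (sym (insertAt-lookup y k true)))))

tight-descends : ∀ {eʳ rʳ e r} → suc eʳ ≤ e → e ≤ suc r → r ≡ suc rʳ → eʳ ≤ suc rʳ
tight-descends eʳ<e e≤r refl = s≤s⁻¹ (≤-trans eʳ<e e≤r)

#relevant<#extremal : (f : BoolFun n) → Positive f → suc (#relevant f) ≤ #extremal f
#relevant<#extremal {zero} f pf = 1≤#extremal f pf
#relevant<#extremal {suc n} f pf with all-false⊎some-true (relevantᵇ f)
... | inj₁ none = subst (λ r → suc r ≤ #extremal f) (sym (countFin-none (suc n) _ none)) (1≤#extremal f pf)
... | inj₂ (k , relₖ) with SplittingVariable.splitting-variable f pf k relₖ
...   | i , relᵢ , b , keeps = begin
  suc (#relevant f)                      ≡⟨ cong suc (#relevant-restrict-relevant f i b relᵢ keeps) ⟩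
  suc (suc (#relevant (restrict f i b))) ≤⟨ s≤s (#relevant<#extremal (restrict f i b) (restrict-positive pf i b)) ⟩
  suc (#extremal (restrict f i b))       ≤⟨ Restriction.restrict<f f pf i relᵢ b ⟩
  #extremal f                            ∎
  where open ≤-Reasoning

linearReadOnce⇒#extremal≤ : (f : BoolFun n) → Positive f → LinearReadOnce f → #extremal f ≤ suc (#relevant f)
linearReadOnce⇒#extremal≤ {zero} f _ _ = constant⇒#extremal≤1 f (f [] , λ { [] → refl })
linearReadOnce⇒#extremal≤ {suc n} f pf lro with linearReadOnce-split f pf lro
... | inj₁ const = ≤-trans (constant⇒#extremal≤1 f const) (s≤s z≤n)
... | inj₂ (k , c , can , lroʳ) with relevantᵇ f k in relₖ
...   | false = ≤-trans (constant⇒#extremal≤1 f (canalizing-irrelevant⇒constant f k c can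
                  (relevantᵇ≡false⇒irrelevant f k relₖ))) (s≤s z≤n)
...   | true  = begin
  #extremal f                                  ≤⟨ Restriction.restrict-constant⇒#extremal≤ f pf k c (canalizing⇒restrict-constant can) ⟩
  suc (#extremal r)                            ≤⟨ s≤s (linearReadOnce⇒#extremal≤ r (restrict-positive pf k (not c)) lroʳ) ⟩
  suc (suc (#relevant r))                      ≡⟨ cong suc (canalizing-#relevant f k c can relₖ) ⟨
  suc (#relevant f)                            ∎
  where
  open ≤-Reasoning
  r = restrict f k (not c)

tight⇒linearReadOnce : (f : BoolFun n) → Positive f → #extremal f ≤ suc (#relevant f) → LinearReadOnce f
tight⇒linearReadOnce {zero} f _ _ = inj₁ (f [] , λ { [] → refl })
tight⇒linearReadOnce {suc n} f pf tight with all-false⊎some-true (relevantᵇ f)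
... | inj₁ none = inj₁ (all-irrelevant⇒constant f λ j → relevantᵇ≡false⇒irrelevant f j (none j))
... | inj₂ (k , relₖ) with SplittingVariable.splitting-variable f pf k relₖ
...   | i , relᵢ , b , keeps = peel (Restriction.tight-restrict⇒canalizing f pf i relᵢ b f≤r
                                      (linearReadOnce⇒constantOrCanalizing r pr (tight⇒linearReadOnce r pr r-tight)))
  where
  r  = restrict f i b
  pr = restrict-positive pf i b
  #relevant-r : #relevant f ≡ suc (#relevant r)
  #relevant-r = #relevant-restrict-relevant f i b relᵢ keeps
  r-tight : #extremal r ≤ suc (#relevant r)
  r-tight = tight-descends (Restriction.restrict<f f pf i relᵢ b) tight #relevant-r
  f≤r : #extremal f ≤ suc (#extremal r)
  f≤r = begin
    #extremal f             ≤⟨ tight ⟩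
    suc (#relevant f)       ≡⟨ cong suc #relevant-r ⟩
    suc (suc (#relevant r)) ≤⟨ s≤s (#relevant<#extremal r pr) ⟩
    suc (#extremal r)       ∎
    where open ≤-Reasoning
  peel : ConstantOrCanalizing f → LinearReadOnce f
  peel (inj₁ const) = inj₁ const
  peel (inj₂ (k , c , can)) with relevantᵇ f k in relₖ
  ... | false = inj₁ (canalizing-irrelevant⇒constant f k c can (relevantᵇ≡false⇒irrelevant f k relₖ))
  ... | true  = canalizing-linearReadOnce f k c can (tight⇒linearReadOnce r′ (restrict-positive pf k (not c))
                  (tight-descends (Restriction.restrict<f f pf k relₖ (not c)) tight (canalizing-#relevant f k c can relₖ)))
    where r′ = restrict f k (not c)

theorem6 : (n : ℕ) (f : BoolFun n) → Positive f →
    (suc (numRelevant f) ≤ numExtremal f)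
    × (numExtremal f ≡ suc (numRelevant f) ⇔ LinearReadOnce f)
theorem6 n f pf rewrite numExtremal≡#extremal f | numRelevant≡#relevant f =
  #relevant<#extremal f pf ,
  mk⇔ (λ tight → tight⇒linearReadOnce f pf (≤-reflexive tight))
      (λ lro → ≤-antisym (linearReadOnce⇒#extremal≤ f pf lro) (#relevant<#extremal f pf))
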